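{- Let $k>1$ be an integer and let $N_k(e_2,p)$ denote the number of $(a_1,\dots,a_k)\in\mathbb{F}_p^k$ with $e_2(a_1,\dots,a_k)\equiv 0 \pmod p$. For every prime $p>2$, \[ N_k(e_2,p)=\begin{cases} p^{k-1}+(p-1)p^{(k-1)/2}\,\eta\big((-1)^{(k-1)/2}(1-\gcd(k-1,p))\big), &\text{if }k\text{ is odd},\\ p^{k-1}+(p-1)p^{(k-2)/2}\,\eta\big((-1)^{k/2+1}(k-1)\big), &\text{if }k\text{ is even}. \end{cases} \] Moreover, \[ N_k(e_2,2)=\frac{1}{4}\left(2^{k+1}+2(\sqrt{2})^{k+1}\cos\left(\frac{\pi}{4}-\frac{k\pi}{4}\right)\right). \]
   Context: $e_2(x_1,\dots,x_k)=\sum_{1\le i<j\le k}x_ix_j$ is the second elementary symmetric polynomial. For an odd prime $p$, $\eta$ denotes the quadratic character of $\mathbb{F}_p$ (the Legendre symbol modulo $p$), extended by $\eta(0)=0$; its arguments are integers read modulo $p$. -}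

module Defs where

open import Data.Nat as ℕ using (ℕ; zero; suc)
open import Data.Nat.Divisibility using (_∣?_)
open import Data.Integer as ℤ using (ℤ; +_; ∣_∣)
open import Data.Fin using (Fin; toℕ)
open import Data.Vec as Vec using (Vec; []; _∷_)
open import Data.List as List using (List; []; _∷_; length; filter; concatMap; map; allFin; upTo)
open import Data.List.Relation.Unary.Any using (Any; any?)
open import Relation.Nullary using (does)
open import Data.Bool using (if_then_else_)

e₂ : ∀ {k} → Vec ℕ k → ℕ
e₂ []       = 0
e₂ (x ∷ xs) = x ℕ.* Vec.sum xs ℕ.+ e₂ xs

-- all elements of F_p^k, with F_p represented by Fin p = {0,…,p-1}
tuples : (p k : ℕ) → List (Vec (Fin p) k)
tuples p zero    = [] ∷ []
tuples p (suc k) = concatMap (λ a → map (a ∷_) (tuples p k)) (allFin p)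

N : (k p : ℕ) → ℕ
N k p = length (filter (λ v → p ∣? e₂ (Vec.map toℕ v)) (tuples p k))

η : (p : ℕ) → ℤ → ℤ
η p a =
  if does (p ∣? ∣ a ∣) then + 0
  else if does (any? (λ x → p ∣? ∣ (+ x ℤ.* + x) ℤ.- a ∣) (upTo p)) then + 1
  else ℤ.-[1+ 0 ]

-- Gaussian integer (re , im) power: (1+i)^n, with re/im parts
record ℤ[i] : Set where
  constructor mkℤ[i]
  field re im : ℤ
open ℤ[i] public

onePlusIPow : ℕ → ℤ[i]
onePlusIPow zero    = mkℤ[i] (+ 1) (+ 0)
onePlusIPow (suc n) with onePlusIPow n
... | mkℤ[i] a b = mkℤ[i] (a ℤ.- b) (a ℤ.+ b)

-- the real number (√2)^(k+1) · cos(π/4 − kπ/4) for k ≥ 1, which equals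
-- 2 · Re((1+i)^(k-1)) since (1+i)^m = (√2)^m e^{imπ/4} and cos is even
sqrt2PowCos : ℕ → ℤ
sqrt2PowCos k = + 2 ℤ.* re (onePlusIPow (k ℕ.∸ 1))

-- For odd p, 2·e₂(x) = (∑x)² - ∑x², so N_k counts the zeros of a quadratic form. Splitting off one
-- coordinate gives N_k = p·rₙ(0) + (p - 1)·pⁿ with n = k - 2, where rₙ(t) counts the representations
-- of t by Qₙ(y) = (∑y)² + ∑y², a form of discriminant n + 1. Completing the square in the last
-- variable shows Qₙ₊₁ ≅ Qₙ ⊕ ⟨(n+2)/(n+1)⟩ when p ∤ n + 1, while rₙ₊₁ = rₙ + (p - 1)·pⁿ⁻¹ when p ∣ n + 1.
-- Adding a square d·a² (d ≉ 0) to a form whose representation function is A + B·δ₀ + C·η gives a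
-- function of the same shape, because ∑ₐ δ₀(t - d·a²) = 1 + η(d)·η(t) and ∑ₐ η(t - d·a²) = η(d)·J(t),
-- where the Jacobi sum J(t) = ∑ᵤ η(u)·η(t - u) equals η(-1)·(p·δ₀(t) - 1). Induction on n, separately
-- for odd and even n, then determines rₙ, and hence N_k, in closed form.
--
-- For p = 2 and x ∈ {0,1}ᵏ, e₂(x) = C(w, 2) with w = ∑x, so (∑x, e₂(x)) mod 2 only depends on w mod 4,
-- and #{x : w ≡ r (mod 4)} = (2ᵏ + 2·Re(i⁻ʳ·(1 + i)ᵏ))/4; this is verified by induction on k.

module Submission where

open import Defs
open import Data.Nat as ℕ using (ℕ; _<_; _∸_; _%_; _/_; _^_)
open import Data.Nat.Primality using (Prime)
open import Data.Nat.GCD using (gcd)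
open import Data.Integer as ℤ using (ℤ; +_)
open import Data.Product using (_×_)
open import Relation.Binary.PropositionalEquality using (_≡_)

open import Level using (0ℓ)
open import Function using (_∘_; _∘′_; id)
open import Data.Bool using (true; false; if_then_else_)
open import Data.Product using (_,_; proj₁; proj₂; ∃; uncurry)
open import Data.Sum using (_⊎_; inj₁; inj₂; [_,_]′)
open import Relation.Nullary using (Dec; yes; no; does; ¬_; contradiction)
open import Relation.Nullary.Decidable as Dec using (dec-true; dec-false)
open import Relation.Unary using (Pred; Decidable)
open import Relation.Binary using (Setoid; IsEquivalence; _Preserves_⟶_; _Preserves₂_⟶_⟶_)
open import Relation.Binary.PropositionalEquality using (refl; sym; trans; cong; cong₂; subst; subst₂; module ≡-Reasoning)
import Relation.Binary.Reasoning.Setoid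
open import Data.Nat using (zero; suc)
import Data.Nat.Properties as ℕ
import Data.Nat.DivMod as ℕ
open import Data.Nat.Divisibility as ℕ using (_∣?_)
open import Data.Nat.Primality using (euclidsLemma; prime⇒nonZero; prime⇒nonTrivial; prime⇒irreducible)
open import Data.Nat.Coprimality as Coprimality using (prime⇒coprime; coprime⇒GCD≡1)
open import Data.Nat.GCD using (module GCD; module Bézout; gcd[m,n]∣m; gcd[m,n]∣n; gcd-greatest)
import Data.Nat.Tactic.RingSolver as ℕ-Solver
open import Data.Integer using (0ℤ; 1ℤ; -1ℤ; _+_; _*_; _-_; -_; _≤_; ∣_∣)
import Data.Integer.Properties as ℤ
open import Data.Integer.Divisibility.Signed as Signed using (_∣_; divides)
open import Data.Integer.DivMod using (_%ℕ_; _/ℕ_; n%ℕd<d; a≡a%ℕn+[a/ℕn]*n)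
open import Data.Integer.Tactic.RingSolver using (solve-∀)
open import Algebra.Properties.AbelianGroup ℤ.+-0-abelianGroup using () renaming (∙-cancelˡ to +-cancelˡ)
open import Algebra.Properties.Semiring.Sum ℤ.+-*-semiring
  using (sum; sum-syntax; sum-cong-≗; sum-replicate-zero; ∑-distrib-+; ∑-comm; *-distribˡ-sum; *-distribʳ-sum)
open import Data.Fin as Fin using (Fin; toℕ; fromℕ<)
import Data.Fin.Properties as Fin
open import Data.Vec as Vec using (Vec; []; _∷_)
open import Data.List as List using (List; []; _∷_; length; filter; concatMap; map; allFin; tabulate; _++_; upTo)
open import Data.List.Relation.Unary.Any as Any using (Any; any?)
open import Data.List.Membership.Propositional using (lose)
open import Data.List.Membership.Propositional.Properties using (∈-upTo⁺)

𝟙 : ∀ {ℓ} {A : Set ℓ} → Dec A → ℤ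
𝟙 d = if does d then 1ℤ else 0ℤ

𝟙-yes : ∀ {ℓ} {A : Set ℓ} (d : Dec A) → A → 𝟙 d ≡ 1ℤ
𝟙-yes (yes _) _ = refl
𝟙-yes (no ¬a) a = contradiction a ¬a

𝟙-no : ∀ {ℓ} {A : Set ℓ} (d : Dec A) → ¬ A → 𝟙 d ≡ 0ℤ
𝟙-no (yes a) ¬a = contradiction a ¬a
𝟙-no (no _)  _  = refl

𝟙-cong : ∀ {ℓ} {A B : Set ℓ} (d : Dec A) (e : Dec B) → (A → B) → (B → A) → 𝟙 d ≡ 𝟙 e
𝟙-cong (yes a) e f g = sym (𝟙-yes e (f a))
𝟙-cong (no ¬a) e f g = sym (𝟙-no e (¬a ∘ g))

0≤𝟙 : ∀ {ℓ} {A : Set ℓ} (d : Dec A) → 0ℤ ≤ 𝟙 d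
0≤𝟙 (yes _) = ℤ.+≤+ ℕ.z≤n
0≤𝟙 (no _)  = ℤ.+≤+ ℕ.z≤n

0≤i⇒0≤j⇒0≤i*j : ∀ {i j} → 0ℤ ≤ i → 0ℤ ≤ j → 0ℤ ≤ i * j
0≤i⇒0≤j⇒0≤i*j {+ m} {+ n} (ℤ.+≤+ _) (ℤ.+≤+ _) = subst (0ℤ ≤_) (ℤ.pos-* m n) (ℤ.+≤+ ℕ.z≤n)

sum-const : ∀ n c → ∑[ i < n ] c ≡ + n * c
sum-const zero    c = sym (ℤ.*-zeroˡ c)
sum-const (suc n) c = begin
  c + ∑[ i < n ] c  ≡⟨ cong (_+_ c) (sum-const n c) ⟩
  c + + n * c       ≡⟨ sym (ℤ.suc-* (+ n) c) ⟩
  + suc n * c       ∎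
  where open ≡-Reasoning

∑-distrib-- : ∀ {n} (f g : Fin n → ℤ) → ∑[ i < n ] (f i - g i) ≡ ∑[ i < n ] f i - ∑[ i < n ] g i
∑-distrib-- f g = begin
  ∑[ i < _ ] (f i - g i)             ≡⟨ ∑-distrib-+ f (-_ ∘ g) ⟩
  sum f + ∑[ i < _ ] (- g i)          ≡⟨ cong (_+_ (sum f)) (sum-cong-≗ (ℤ.-1*i≡-i ∘ g)) ⟨
  sum f + ∑[ i < _ ] (-1ℤ * g i)      ≡⟨ cong (_+_ (sum f)) (*-distribˡ-sum -1ℤ g) ⟨
  sum f + -1ℤ * sum g                 ≡⟨ cong (_+_ (sum f)) (ℤ.-1*i≡-i (sum g)) ⟩
  sum f - sum g                       ∎
  where open ≡-Reasoning

∑-𝟙≟ : ∀ {n} (j : Fin n) → ∑[ i < n ] 𝟙 (i Fin.≟ j) ≡ 1ℤ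
∑-𝟙≟ {suc n} Fin.zero    = cong (_+_ 1ℤ) (sum-replicate-zero n)
∑-𝟙≟ {suc n} (Fin.suc j) = trans (ℤ.+-identityˡ _) (∑-𝟙≟ j)

∑-nonneg : ∀ {n} (f : Fin n → ℤ) → (∀ i → 0ℤ ≤ f i) → 0ℤ ≤ sum f
∑-nonneg {zero}  f f≥0 = ℤ.≤-refl
∑-nonneg {suc n} f f≥0 = ℤ.+-mono-≤ (f≥0 Fin.zero) (∑-nonneg (f ∘ Fin.suc) (f≥0 ∘ Fin.suc))

∑-nonneg≡0⇒≡0 : ∀ {n} (f : Fin n → ℤ) → (∀ i → 0ℤ ≤ f i) → sum f ≡ 0ℤ → ∀ i → f i ≡ 0ℤ
∑-nonneg≡0⇒≡0 {suc n} f f≥0 ∑f≡0 = λ where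
    Fin.zero    → proj₁ parts
    (Fin.suc i) → ∑-nonneg≡0⇒≡0 (f ∘ Fin.suc) (f≥0 ∘ Fin.suc) (proj₂ parts) i
  where
  nonneg-+≡0 : ∀ {a b} → 0ℤ ≤ a → 0ℤ ≤ b → a + b ≡ 0ℤ → a ≡ 0ℤ × b ≡ 0ℤ
  nonneg-+≡0 {a} {b} a≥0 b≥0 a+b≡0 = a≡0 , trans (sym (ℤ.+-identityˡ b)) (subst (λ x → x + b ≡ 0ℤ) a≡0 a+b≡0)
    where a≡0 = ℤ.≤-antisym (subst₂ _≤_ (ℤ.+-identityʳ a) a+b≡0 (ℤ.+-monoʳ-≤ a b≥0)) a≥0
  parts = nonneg-+≡0 (f≥0 Fin.zero) (∑-nonneg (f ∘ Fin.suc) (f≥0 ∘ Fin.suc)) ∑f≡0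

∑ˡ : ∀ {A : Set} → (A → ℤ) → List A → ℤ
∑ˡ f = List.foldr (λ x s → f x + s) 0ℤ

length-filter≡∑ˡ𝟙 : ∀ {A : Set} {P : Pred A 0ℓ} (P? : Decidable P) xs →
                     + length (filter P? xs) ≡ ∑ˡ (𝟙 ∘ P?) xs
length-filter≡∑ˡ𝟙 P? [] = refl
length-filter≡∑ˡ𝟙 P? (x ∷ xs) with does (P? x)
... | false = trans (length-filter≡∑ˡ𝟙 P? xs) (sym (ℤ.+-identityˡ _))
... | true  = cong (_+_ 1ℤ) (length-filter≡∑ˡ𝟙 P? xs)

∑ˡ-++ : ∀ {A : Set} (f : A → ℤ) xs ys → ∑ˡ f (xs ++ ys) ≡ ∑ˡ f xs + ∑ˡ f ys
∑ˡ-++ f []       ys = sym (ℤ.+-identityˡ _)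
∑ˡ-++ f (x ∷ xs) ys = trans (cong (_+_ (f x)) (∑ˡ-++ f xs ys)) (sym (ℤ.+-assoc (f x) _ _))

∑ˡ-concatMap : ∀ {A B : Set} (f : B → ℤ) (g : A → List B) xs →
               ∑ˡ f (concatMap g xs) ≡ ∑ˡ (∑ˡ f ∘ g) xs
∑ˡ-concatMap f g []       = refl
∑ˡ-concatMap f g (x ∷ xs) =
  trans (∑ˡ-++ f (g x) (concatMap g xs)) (cong (_+_ (∑ˡ f (g x))) (∑ˡ-concatMap f g xs))

∑ˡ-map : ∀ {A B : Set} (f : B → ℤ) (g : A → B) xs → ∑ˡ f (map g xs) ≡ ∑ˡ (f ∘ g) xs
∑ˡ-map f g []       = refl
∑ˡ-map f g (x ∷ xs) = cong (_+_ (f (g x))) (∑ˡ-map f g xs)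

∑ˡ-tabulate : ∀ {A : Set} {n} (f : A → ℤ) (g : Fin n → A) → ∑ˡ f (tabulate g) ≡ ∑[ i < n ] f (g i)
∑ˡ-tabulate {n = zero}  f g = refl
∑ˡ-tabulate {n = suc n} f g = cong (_+_ (f (g Fin.zero))) (∑ˡ-tabulate f (g ∘ Fin.suc))

∑ᵛ : (p k : ℕ) → (Vec ℕ k → ℤ) → ℤ
∑ᵛ p zero    φ = φ []
∑ᵛ p (suc k) φ = ∑[ a < p ] ∑ᵛ p k (λ v → φ (toℕ a ∷ v))

∑ᵛ-cong : ∀ p k {φ ψ : Vec ℕ k → ℤ} → (∀ v → φ v ≡ ψ v) → ∑ᵛ p k φ ≡ ∑ᵛ p k ψ
∑ᵛ-cong p zero    φ≗ψ = φ≗ψ []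
∑ᵛ-cong p (suc k) φ≗ψ = sum-cong-≗ {p} (λ a → ∑ᵛ-cong p k (λ v → φ≗ψ (toℕ a ∷ v)))

∑ˡ-tuples : ∀ p k (φ : Vec ℕ k → ℤ) → ∑ˡ (φ ∘ Vec.map toℕ) (tuples p k) ≡ ∑ᵛ p k φ
∑ˡ-tuples p zero    φ = ℤ.+-identityʳ (φ [])
∑ˡ-tuples p (suc k) φ = begin
  ∑ˡ (φ ∘ Vec.map toℕ) (concatMap (λ a → map (a ∷_) (tuples p k)) (allFin p))
    ≡⟨ ∑ˡ-concatMap (φ ∘ Vec.map toℕ) (λ a → map (a ∷_) (tuples p k)) (allFin p) ⟩
  ∑ˡ (λ a → ∑ˡ (φ ∘ Vec.map toℕ) (map (a ∷_) (tuples p k))) (allFin p)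
    ≡⟨ ∑ˡ-tabulate (λ a → ∑ˡ (φ ∘ Vec.map toℕ) (map (a ∷_) (tuples p k))) id ⟩
  ∑[ a < p ] ∑ˡ (φ ∘ Vec.map toℕ) (map (a ∷_) (tuples p k))
    ≡⟨ sum-cong-≗ {p} (λ a → trans (∑ˡ-map (φ ∘ Vec.map toℕ) (a ∷_) (tuples p k)) (∑ˡ-tuples p k (λ v → φ (toℕ a ∷ v)))) ⟩
  ∑ᵛ p (suc k) φ ∎
  where open ≡-Reasoning

N≡∑ᵛ : ∀ k p → + N k p ≡ ∑ᵛ p k (λ v → 𝟙 (p ∣? e₂ v))
N≡∑ᵛ k p = trans (length-filter≡∑ˡ𝟙 _ (tuples p k)) (∑ˡ-tuples p k (λ v → 𝟙 (p ∣? e₂ v)))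

sumSq : ∀ {k} → Vec ℕ k → ℕ
sumSq []       = 0
sumSq (x ∷ xs) = x ℕ.* x ℕ.+ sumSq xs

2e₂+sumSq≡sum² : ∀ {k} (v : Vec ℕ k) → 2 ℕ.* e₂ v ℕ.+ sumSq v ≡ Vec.sum v ℕ.* Vec.sum v
2e₂+sumSq≡sum² []       = refl
2e₂+sumSq≡sum² (a ∷ v) = begin
  2 ℕ.* (a ℕ.* s ℕ.+ e₂ v) ℕ.+ (a ℕ.* a ℕ.+ sumSq v)    ≡⟨ regroup a s (e₂ v) (sumSq v) ⟩
  2 ℕ.* a ℕ.* s ℕ.+ a ℕ.* a ℕ.+ (2 ℕ.* e₂ v ℕ.+ sumSq v) ≡⟨ cong (2 ℕ.* a ℕ.* s ℕ.+ a ℕ.* a ℕ.+_) (2e₂+sumSq≡sum² v) ⟩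
  2 ℕ.* a ℕ.* s ℕ.+ a ℕ.* a ℕ.+ s ℕ.* s                  ≡⟨ square a s ⟩
  (a ℕ.+ s) ℕ.* (a ℕ.+ s)                                ∎
  where
  open ≡-Reasoning
  s = Vec.sum v
  regroup : ∀ a s e q → 2 ℕ.* (a ℕ.* s ℕ.+ e) ℕ.+ (a ℕ.* a ℕ.+ q) ≡ 2 ℕ.* a ℕ.* s ℕ.+ a ℕ.* a ℕ.+ (2 ℕ.* e ℕ.+ q)
  regroup = ℕ-Solver.solve-∀
  square : ∀ a s → 2 ℕ.* a ℕ.* s ℕ.+ a ℕ.* a ℕ.+ s ℕ.* s ≡ (a ℕ.+ s) ℕ.* (a ℕ.+ s)
  square = ℕ-Solver.solve-∀

module Residues {p : ℕ} (p-prime : Prime p) where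

  instance
    p≢0 : ℕ.NonZero p
    p≢0 = prime⇒nonZero p-prime

  infix 4 _≈_ _≉_ _≈?_

  -- Congruence modulo p; a record rather than a synonym so that a and b can be inferred.
  record _≈_ (a b : ℤ) : Set where
    constructor ≈-intro
    field ≈-elim : + p ∣ a - b
  open _≈_

  _≉_ : ℤ → ℤ → Set
  a ≉ b = ¬ a ≈ b

  _≈?_ : ∀ a b → Dec (a ≈ b)
  a ≈? b = Dec.map′ ≈-intro ≈-elim (+ p Signed.∣? a - b)

  ≈-by : ∀ {a b} q → a - b ≡ q * + p → a ≈ b
  ≈-by q eq = ≈-intro (divides q eq)

  ≈-refl : ∀ {a} → a ≈ a
  ≈-refl {a} = ≈-by 0ℤ (ℤ.+-inverseʳ a)

  ≈-reflexive : ∀ {a b} → a ≡ b → a ≈ b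
  ≈-reflexive refl = ≈-refl

  ≈-sym : ∀ {a b} → a ≈ b → b ≈ a
  ≈-sym {a} {b} (≈-intro a≈b) = ≈-intro (subst (+ p ∣_) (-[a-b]≡b-a a b) (Signed.∣m⇒∣-m a≈b))
    where -[a-b]≡b-a : ∀ a b → - (a - b) ≡ b - a
          -[a-b]≡b-a = solve-∀

  ≈-trans : ∀ {a b c} → a ≈ b → b ≈ c → a ≈ c
  ≈-trans {a} {b} {c} (≈-intro a≈b) (≈-intro b≈c) =
    ≈-intro (subst (+ p ∣_) (telescope a b c) (Signed.∣m∣n⇒∣m+n a≈b b≈c))
    where telescope : ∀ a b c → (a - b) + (b - c) ≡ a - c
          telescope = solve-∀

  ≈-isEquivalence : IsEquivalence _≈_
  ≈-isEquivalence = record { refl = ≈-refl ; sym = ≈-sym ; trans = ≈-trans }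

  ≈-setoid : Setoid _ _
  ≈-setoid = record { isEquivalence = ≈-isEquivalence }

  module ≈-Reasoning = Relation.Binary.Reasoning.Setoid ≈-setoid

  +-cong : ∀ {a b c d} → a ≈ b → c ≈ d → a + c ≈ b + d
  +-cong {a} {b} {c} {d} (≈-intro a≈b) (≈-intro c≈d) =
    ≈-intro (subst (+ p ∣_) (regroup a b c d) (Signed.∣m∣n⇒∣m+n a≈b c≈d))
    where regroup : ∀ a b c d → (a - b) + (c - d) ≡ (a + c) - (b + d)
          regroup = solve-∀

  +-congˡ : ∀ c {a b} → a ≈ b → c + a ≈ c + b
  +-congˡ c = +-cong (≈-refl {c})

  +-congʳ : ∀ c {a b} → a ≈ b → a + c ≈ b + c
  +-congʳ c a≈b = +-cong a≈b (≈-refl {c})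

  -‿cong : ∀ {a b} → a ≈ b → - a ≈ - b
  -‿cong {a} {b} (≈-intro a≈b) = ≈-intro (subst (+ p ∣_) (regroup a b) (Signed.∣m⇒∣-m a≈b))
    where regroup : ∀ a b → - (a - b) ≡ - a - - b
          regroup = solve-∀

  *-cong : ∀ {a b c d} → a ≈ b → c ≈ d → a * c ≈ b * d
  *-cong {a} {b} {c} {d} (≈-intro a≈b) (≈-intro c≈d) =
    ≈-intro (subst (+ p ∣_) (regroup a b c d) (Signed.∣m∣n⇒∣m+n (Signed.∣m⇒∣m*n c a≈b) (Signed.∣n⇒∣m*n b c≈d)))
    where regroup : ∀ a b c d → (a - b) * c + b * (c - d) ≡ a * c - b * d
          regroup = solve-∀

  *-congˡ : ∀ c {a b} → a ≈ b → c * a ≈ c * b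
  *-congˡ c = *-cong (≈-refl {c})

  *-congʳ : ∀ c {a b} → a ≈ b → a * c ≈ b * c
  *-congʳ c a≈b = *-cong a≈b (≈-refl {c})

  p≈0 : + p ≈ 0ℤ
  p≈0 = ≈-by 1ℤ (trans (ℤ.+-identityʳ (+ p)) (sym (ℤ.*-identityˡ (+ p))))

  ≈0⇒∣ : ∀ {a} → a ≈ 0ℤ → p ℕ.∣ ∣ a ∣
  ≈0⇒∣ {a} (≈-intro a≈0) = subst (λ x → p ℕ.∣ ∣ x ∣) (ℤ.+-identityʳ a) (Signed.∣⇒∣ᵤ a≈0)

  ∣⇒≈0 : ∀ {a} → p ℕ.∣ ∣ a ∣ → a ≈ 0ℤ
  ∣⇒≈0 {a} p∣a = ≈-intro (Signed.∣ᵤ⇒∣ (subst (λ x → p ℕ.∣ ∣ x ∣) (sym (ℤ.+-identityʳ a)) p∣a))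

  ≈⇒-≈0 : ∀ {a b} → a ≈ b → a - b ≈ 0ℤ
  ≈⇒-≈0 {a} {b} (≈-intro a≈b) = ∣⇒≈0 (Signed.∣⇒∣ᵤ a≈b)

  -≈0⇒≈ : ∀ {a b} → a - b ≈ 0ℤ → a ≈ b
  -≈0⇒≈ {a} {b} a-b≈0 = ≈-intro (Signed.∣ᵤ⇒∣ (≈0⇒∣ a-b≈0))

  *≈0⇒≈0⊎≈0 : ∀ {a b} → a * b ≈ 0ℤ → a ≈ 0ℤ ⊎ b ≈ 0ℤ
  *≈0⇒≈0⊎≈0 {a} {b} ab≈0 with euclidsLemma ∣ a ∣ ∣ b ∣ p-prime (subst (p ℕ.∣_) (ℤ.abs-* a b) (≈0⇒∣ ab≈0))
  ... | inj₁ p∣a = inj₁ (∣⇒≈0 p∣a)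
  ... | inj₂ p∣b = inj₂ (∣⇒≈0 p∣b)

  *-≉0 : ∀ {a b} → a ≉ 0ℤ → b ≉ 0ℤ → a * b ≉ 0ℤ
  *-≉0 a≉0 b≉0 = [ a≉0 , b≉0 ]′ ∘ *≈0⇒≈0⊎≈0

  *-cancelˡ-≈ : ∀ {a x y} → a ≉ 0ℤ → a * x ≈ a * y → x ≈ y
  *-cancelˡ-≈ {a} {x} {y} a≉0 ax≈ay with *≈0⇒≈0⊎≈0 (≈-trans (≈-reflexive (factor a x y)) (≈⇒-≈0 ax≈ay))
    where factor : ∀ a x y → a * (x - y) ≡ a * x - a * y
          factor = solve-∀
  ... | inj₁ a≈0   = contradiction a≈0 a≉0
  ... | inj₂ x-y≈0 = -≈0⇒≈ x-y≈0

  +n≈0⇒n≡0 : ∀ {n} → n ℕ.< p → + n ≈ 0ℤ → n ≡ 0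
  +n≈0⇒n≡0 {zero}  _   _    = refl
  +n≈0⇒n≡0 {suc n} n<p n≈0 = contradiction (ℕ.∣⇒≤ (≈0⇒∣ n≈0)) (ℕ.<⇒≱ n<p)

  1≉0 : 1ℤ ≉ 0ℤ
  1≉0 1≈0 = ℕ.1+n≢0 (+n≈0⇒n≡0 (ℕ.nonTrivial⇒n>1 p {{prime⇒nonTrivial p-prime}}) 1≈0)

  residue : ℤ → ℕ
  residue a = a %ℕ p

  residue<p : ∀ a → residue a ℕ.< p
  residue<p a = n%ℕd<d a p

  residue≈ : ∀ a → + residue a ≈ a
  residue≈ a = ≈-by (- (a /ℕ p)) (begin
    + residue a - a                                ≡⟨ cong (λ x → + residue a - x) (a≡a%ℕn+[a/ℕn]*n a p) ⟩
    + residue a - (+ residue a + (a /ℕ p) * + p)   ≡⟨ cancel (+ residue a) (a /ℕ p) (+ p) ⟩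
    - (a /ℕ p) * + p                               ∎)
    where open ≡-Reasoning
          cancel : ∀ r q p → r - (r + q * p) ≡ - q * p
          cancel = solve-∀

  private
    ≤-<p-≈⇒≡ : ∀ {x y} → x ℕ.< p → y ℕ.≤ x → + x ≈ + y → x ≡ y
    ≤-<p-≈⇒≡ {x} {y} x<p y≤x x≈y = ℕ.≤-antisym (ℕ.m∸n≡0⇒m≤n x∸y≡0) y≤x
      where
      x∸y≈0 : + (x ℕ.∸ y) ≈ 0ℤ
      x∸y≈0 = ≈-trans (≈-reflexive (sym (trans (ℤ.m-n≡m⊖n x y) (ℤ.⊖-≥ y≤x)))) (≈⇒-≈0 x≈y)
      x∸y≡0 = +n≈0⇒n≡0 (ℕ.≤-<-trans (ℕ.m∸n≤m x y) x<p) x∸y≈0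

  <p-≈⇒≡ : ∀ {x y} → x ℕ.< p → y ℕ.< p → + x ≈ + y → x ≡ y
  <p-≈⇒≡ {x} {y} x<p y<p x≈y with ℕ.≤-total y x
  ... | inj₁ y≤x = ≤-<p-≈⇒≡ x<p y≤x x≈y
  ... | inj₂ x≤y = sym (≤-<p-≈⇒≡ y<p x≤y (≈-sym x≈y))

  private
    bézout-coefficient : ∀ {d m} → Bézout.Identity d m p → ℤ
    bézout-coefficient (Bézout.+- x _ _) = + x
    bézout-coefficient (Bézout.-+ x _ _) = - + x

    bézout-coefficient-correct : ∀ {d m} (b : Bézout.Identity d m p) → + m * bézout-coefficient b ≈ + d
    bézout-coefficient-correct {d} {m} (Bézout.+- x y eq) = begin
      + m * + x              ≡⟨ trans (ℤ.*-comm (+ m) (+ x)) (sym (ℤ.pos-* x m)) ⟩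
      + (x ℕ.* m)            ≡⟨ cong +_ eq ⟨
      + (d ℕ.+ y ℕ.* p)      ≡⟨ trans (ℤ.pos-+ d (y ℕ.* p)) (cong (_+_ (+ d)) (ℤ.pos-* y p)) ⟩
      + d + + y * + p        ≈⟨ +-congˡ (+ d) (*-congˡ (+ y) p≈0) ⟩
      + d + + y * 0ℤ         ≡⟨ drop (+ d) (+ y) ⟩
      + d                    ∎
      where open ≈-Reasoning
            drop : ∀ d y → d + y * 0ℤ ≡ d
            drop = solve-∀
    bézout-coefficient-correct {d} {m} (Bézout.-+ x y eq) = begin
      + m * - + x            ≡⟨ regroup (+ d) (+ m) (+ x) ⟩
      + d - (+ d + + x * + m) ≡⟨ cong (λ z → + d - (+ d + z)) (ℤ.pos-* x m) ⟨
      + d - (+ d + + (x ℕ.* m)) ≡⟨ cong (λ z → + d - z) (ℤ.pos-+ d (x ℕ.* m)) ⟨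
      + d - + (d ℕ.+ x ℕ.* m) ≡⟨ cong (λ z → + d - + z) eq ⟩
      + d - + (y ℕ.* p)      ≡⟨ cong (λ z → + d - z) (ℤ.pos-* y p) ⟩
      + d - + y * + p        ≈⟨ +-congˡ (+ d) (-‿cong (*-congˡ (+ y) p≈0)) ⟩
      + d - + y * 0ℤ         ≡⟨ drop (+ d) (+ y) ⟩
      + d                    ∎
      where open ≈-Reasoning
            regroup : ∀ d m x → m * - x ≡ d - (d + x * m)
            regroup = solve-∀
            drop : ∀ d y → d - y * 0ℤ ≡ d
            drop = solve-∀

  -- A Bézout coefficient of the residue of a; meaningless when a ≈ 0.
  inverse : ℤ → ℤ
  inverse a with Bézout.lemma (residue a) p
  ... | Bézout.result _ _ b = bézout-coefficient b

  *-inverseʳ : ∀ {a} → a ≉ 0ℤ → a * inverse a ≈ 1ℤ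
  *-inverseʳ {a} a≉0 with Bézout.lemma (residue a) p
  ... | Bézout.result d g b = begin
    a * bézout-coefficient b            ≈⟨ *-congʳ (bézout-coefficient b) (≈-sym (residue≈ a)) ⟩
    + residue a * bézout-coefficient b  ≈⟨ bézout-coefficient-correct b ⟩
    + d                                 ≡⟨ cong +_ (GCD.unique g (coprime⇒GCD≡1 residue-coprime)) ⟩
    1ℤ                                  ∎
    where
    open ≈-Reasoning
    instance
      residue≢0 : ℕ.NonZero (residue a)
      residue≢0 = ℕ.≢-nonZero (λ r≡0 → a≉0 (≈-trans (≈-sym (residue≈ a)) (≈-reflexive (cong +_ r≡0))))
    residue-coprime = Coprimality.sym (prime⇒coprime p-prime (residue<p a))

  *-inverseˡ : ∀ {a} → a ≉ 0ℤ → inverse a * a ≈ 1ℤ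
  *-inverseˡ {a} a≉0 = ≈-trans (≈-reflexive (ℤ.*-comm (inverse a) a)) (*-inverseʳ a≉0)

  -- 𝔽ₚ is ℤ modulo ≈, and ∑ₚ sums over the representatives 0, …, p - 1.
  infix 10 ∑ₚ
  ∑ₚ : (ℤ → ℤ) → ℤ
  ∑ₚ f = ∑[ i < p ] f (+ toℕ i)
  syntax ∑ₚ (λ x → e) = ∑ₚ[ x ] e

  ∑ₚ-cong : ∀ {f g : ℤ → ℤ} → (∀ x → f x ≡ g x) → ∑ₚ f ≡ ∑ₚ g
  ∑ₚ-cong f≗g = sum-cong-≗ {p} (λ i → f≗g (+ toℕ i))

  ∑ₚ-+ : ∀ (f g : ℤ → ℤ) → ∑ₚ[ x ] (f x + g x) ≡ ∑ₚ f + ∑ₚ g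
  ∑ₚ-+ f g = ∑-distrib-+ {p} (f ∘ +_ ∘ toℕ) (g ∘ +_ ∘ toℕ)

  ∑ₚ-- : ∀ (f g : ℤ → ℤ) → ∑ₚ[ x ] (f x - g x) ≡ ∑ₚ f - ∑ₚ g
  ∑ₚ-- f g = ∑-distrib-- {p} (f ∘ +_ ∘ toℕ) (g ∘ +_ ∘ toℕ)

  ∑ₚ-*ˡ : ∀ c (f : ℤ → ℤ) → ∑ₚ[ x ] (c * f x) ≡ c * ∑ₚ f
  ∑ₚ-*ˡ c f = sym (*-distribˡ-sum {p} c (f ∘ +_ ∘ toℕ))

  ∑ₚ-*ʳ : ∀ c (f : ℤ → ℤ) → ∑ₚ[ x ] (f x * c) ≡ ∑ₚ f * c
  ∑ₚ-*ʳ c f = sym (*-distribʳ-sum {p} c (f ∘ +_ ∘ toℕ))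

  ∑ₚ-const : ∀ c → ∑ₚ[ x ] c ≡ + p * c
  ∑ₚ-const = sum-const p

  ∑ₚ-comm : ∀ (f : ℤ → ℤ → ℤ) → ∑ₚ[ x ] ∑ₚ[ y ] f x y ≡ ∑ₚ[ y ] ∑ₚ[ x ] f x y
  ∑ₚ-comm f = ∑-comm {p} {p} (λ i j → f (+ toℕ i) (+ toℕ j))

  δ : ℤ → ℤ → ℤ
  δ a b = 𝟙 (a ≈? b)

  δ-≈ : ∀ {a b} → a ≈ b → δ a b ≡ 1ℤ
  δ-≈ {a} {b} = 𝟙-yes (a ≈? b)

  δ-≉ : ∀ {a b} → a ≉ b → δ a b ≡ 0ℤ
  δ-≉ {a} {b} = 𝟙-no (a ≈? b)

  δ-cong : ∀ {a b c d} → (a ≈ b → c ≈ d) → (c ≈ d → a ≈ b) → δ a b ≡ δ c d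
  δ-cong {a} {b} {c} {d} = 𝟙-cong (a ≈? b) (c ≈? d)

  δ-congˡ : ∀ {a a′} b → a ≈ a′ → δ a b ≡ δ a′ b
  δ-congˡ {a} {a′} b a≈a′ = δ-cong {a} {b} {a′} {b} (≈-trans (≈-sym a≈a′)) (≈-trans a≈a′)

  δ-sym : ∀ a b → δ a b ≡ δ b a
  δ-sym a b = δ-cong {a} {b} {b} {a} ≈-sym ≈-sym

  representative : ℤ → Fin p
  representative a = fromℕ< (residue<p a)

  representative≈ : ∀ a → + toℕ (representative a) ≈ a
  representative≈ a = ≈-trans (≈-reflexive (cong +_ (Fin.toℕ-fromℕ< (residue<p a)))) (residue≈ a)

  ∑ₚ-δ : ∀ c → ∑ₚ[ x ] δ x c ≡ 1ℤ
  ∑ₚ-δ c = trans (sum-cong-≗ {p} δ≡𝟙≟) (∑-𝟙≟ (representative c))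
    where
    δ≡𝟙≟ : ∀ i → δ (+ toℕ i) c ≡ 𝟙 (i Fin.≟ representative c)
    δ≡𝟙≟ i = 𝟙-cong (+ toℕ i ≈? c) (i Fin.≟ representative c)
      (λ i≈c → Fin.toℕ-injective (<p-≈⇒≡ (Fin.toℕ<n i) (Fin.toℕ<n (representative c))
                                           (≈-trans i≈c (≈-sym (representative≈ c)))))
      (λ { refl → representative≈ c })

  ∑ₚ-nonneg≡0⇒≡0 : ∀ {F : ℤ → ℤ} → F Preserves _≈_ ⟶ _≡_ → (∀ x → 0ℤ ≤ F x) → ∑ₚ F ≡ 0ℤ →
                   ∀ x → F x ≡ 0ℤ
  ∑ₚ-nonneg≡0⇒≡0 {F} F-cong F≥0 ∑F≡0 x =
    trans (F-cong (≈-sym (representative≈ x)))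
          (∑-nonneg≡0⇒≡0 (F ∘ +_ ∘ toℕ) (F≥0 ∘ +_ ∘ toℕ) ∑F≡0 (representative x))

  ∑ₚ-δ-* : ∀ {F : ℤ → ℤ} → F Preserves _≈_ ⟶ _≡_ → ∀ c → ∑ₚ[ y ] (δ y c * F y) ≡ F c
  ∑ₚ-δ-* {F} F-cong c = begin
    ∑ₚ[ y ] (δ y c * F y)  ≡⟨ ∑ₚ-cong sift ⟩
    ∑ₚ[ y ] (δ y c * F c)  ≡⟨ ∑ₚ-*ʳ (F c) (λ y → δ y c) ⟩
    ∑ₚ[ y ] δ y c * F c    ≡⟨ cong (_* F c) (∑ₚ-δ c) ⟩
    1ℤ * F c               ≡⟨ ℤ.*-identityˡ (F c) ⟩
    F c                    ∎
    where
    open ≡-Reasoning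
    sift : ∀ y → δ y c * F y ≡ δ y c * F c
    sift y with y ≈? c
    ... | yes y≈c = cong (δ y c *_) (F-cong y≈c)
    ... | no  y≉c = trans (cong (_* F y) (δ-≉ y≉c)) (sym (cong (_* F c) (δ-≉ y≉c)))

  ∑ₚ-by-cases : ∀ {f : ℤ → ℤ} {X Y} → (∀ {t} → t ≈ 0ℤ → f t ≡ X) → (∀ {t} → t ≉ 0ℤ → f t ≡ Y) →
                ∑ₚ f ≡ X + (+ p - 1ℤ) * Y
  ∑ₚ-by-cases {f} {X} {Y} f₀ f₁ = begin
    ∑ₚ f                                                ≡⟨ ∑ₚ-cong split ⟩
    ∑ₚ[ t ] (δ t 0ℤ * X + (1ℤ - δ t 0ℤ) * Y)            ≡⟨ ∑ₚ-+ (λ t → δ t 0ℤ * X) (λ t → (1ℤ - δ t 0ℤ) * Y) ⟩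
    ∑ₚ[ t ] (δ t 0ℤ * X) + ∑ₚ[ t ] ((1ℤ - δ t 0ℤ) * Y)  ≡⟨ cong₂ _+_ (∑ₚ-*ʳ X (λ t → δ t 0ℤ)) (∑ₚ-*ʳ Y (λ t → 1ℤ - δ t 0ℤ)) ⟩
    ∑ₚ[ t ] δ t 0ℤ * X + ∑ₚ[ t ] (1ℤ - δ t 0ℤ) * Y      ≡⟨ cong₂ (λ a b → a * X + b * Y) (∑ₚ-δ 0ℤ) ∑ₚ[1-δ]≡p-1 ⟩
    1ℤ * X + (+ p - 1ℤ) * Y                             ≡⟨ cong (_+ (+ p - 1ℤ) * Y) (ℤ.*-identityˡ X) ⟩
    X + (+ p - 1ℤ) * Y                                  ∎
    where
    open ≡-Reasoning
    ∑ₚ[1-δ]≡p-1 : ∑ₚ[ t ] (1ℤ - δ t 0ℤ) ≡ + p - 1ℤ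
    ∑ₚ[1-δ]≡p-1 = trans (∑ₚ-- (λ _ → 1ℤ) (λ t → δ t 0ℤ)) (cong₂ _-_ (trans (∑ₚ-const 1ℤ) (ℤ.*-identityʳ (+ p))) (∑ₚ-δ 0ℤ))
    only-X : ∀ X Y → X ≡ 1ℤ * X + (1ℤ - 1ℤ) * Y
    only-X = solve-∀
    only-Y : ∀ X Y → Y ≡ 0ℤ * X + (1ℤ - 0ℤ) * Y
    only-Y = solve-∀
    split : ∀ t → f t ≡ δ t 0ℤ * X + (1ℤ - δ t 0ℤ) * Y
    split t with t ≈? 0ℤ
    ... | yes t≈0 = trans (f₀ t≈0) (trans (only-X X Y) (cong (λ z → z * X + (1ℤ - z) * Y) (sym (δ-≈ t≈0))))
    ... | no  t≉0 = trans (f₁ t≉0) (trans (only-Y X Y) (cong (λ z → z * X + (1ℤ - z) * Y) (sym (δ-≉ t≉0))))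

  ∑ₚ-fibres : ∀ {F : ℤ → ℤ} → F Preserves _≈_ ⟶ _≡_ → ∀ (g : ℤ → ℤ) →
              ∑ₚ[ x ] F (g x) ≡ ∑ₚ[ y ] (F y * ∑ₚ[ x ] δ (g x) y)
  ∑ₚ-fibres {F} F-cong g = begin
    ∑ₚ[ x ] F (g x)                        ≡⟨ ∑ₚ-cong (λ x → sym (∑ₚ-δ-* F-cong (g x))) ⟩
    ∑ₚ[ x ] ∑ₚ[ y ] (δ y (g x) * F y)      ≡⟨ ∑ₚ-cong (λ x → ∑ₚ-cong (λ y → cong (_* F y) (δ-sym y (g x)))) ⟩
    ∑ₚ[ x ] ∑ₚ[ y ] (δ (g x) y * F y)      ≡⟨ ∑ₚ-comm (λ x y → δ (g x) y * F y) ⟩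
    ∑ₚ[ y ] ∑ₚ[ x ] (δ (g x) y * F y)      ≡⟨ ∑ₚ-cong (λ y → ∑ₚ-*ʳ (F y) (λ x → δ (g x) y)) ⟩
    ∑ₚ[ y ] (∑ₚ[ x ] δ (g x) y * F y)      ≡⟨ ∑ₚ-cong (λ y → ℤ.*-comm (∑ₚ[ x ] δ (g x) y) (F y)) ⟩
    ∑ₚ[ y ] (F y * ∑ₚ[ x ] δ (g x) y)      ∎
    where open ≡-Reasoning

  ∑ₚ-reindex : ∀ {F : ℤ → ℤ} → F Preserves _≈_ ⟶ _≡_ → ∀ (g h : ℤ → ℤ) →
               (∀ {x y} → g x ≈ y → x ≈ h y) → (∀ {x y} → x ≈ h y → g x ≈ y) →
               ∑ₚ[ x ] F (g x) ≡ ∑ₚ F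
  ∑ₚ-reindex {F} F-cong g h g⇒h h⇒g = begin
    ∑ₚ[ x ] F (g x)                    ≡⟨ ∑ₚ-fibres F-cong g ⟩
    ∑ₚ[ y ] (F y * ∑ₚ[ x ] δ (g x) y)  ≡⟨ ∑ₚ-cong (λ y → cong (F y *_) (fibre≡1 y)) ⟩
    ∑ₚ[ y ] (F y * 1ℤ)                 ≡⟨ ∑ₚ-cong (λ y → ℤ.*-identityʳ (F y)) ⟩
    ∑ₚ F                               ∎
    where
    open ≡-Reasoning
    fibre≡1 : ∀ y → ∑ₚ[ x ] δ (g x) y ≡ 1ℤ
    fibre≡1 y = trans (∑ₚ-cong (λ x → δ-cong {g x} {y} {x} {h y} g⇒h h⇒g)) (∑ₚ-δ (h y))

  ∑ₚ-shift : ∀ {F : ℤ → ℤ} → F Preserves _≈_ ⟶ _≡_ → ∀ c → ∑ₚ[ x ] F (x + c) ≡ ∑ₚ F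
  ∑ₚ-shift F-cong c = ∑ₚ-reindex F-cong (_+ c) (_- c)
    (λ {x} {y} x+c≈y → ≈-trans (≈-reflexive (shift x c)) (+-congʳ (- c) x+c≈y))
    (λ {x} {y} x≈y-c → ≈-trans (+-congʳ c x≈y-c) (≈-reflexive (unshift y c)))
    where shift : ∀ x c → x ≡ x + c - c
          shift = solve-∀
          unshift : ∀ y c → y - c + c ≡ y
          unshift = solve-∀

  ∑ₚ-reflect : ∀ {F : ℤ → ℤ} → F Preserves _≈_ ⟶ _≡_ → ∀ t → ∑ₚ[ x ] F (t - x) ≡ ∑ₚ F
  ∑ₚ-reflect F-cong t = ∑ₚ-reindex F-cong (_-_ t) (_-_ t)
    (λ {x} {y} t-x≈y → ≈-trans (≈-reflexive (involutive t x)) (+-congˡ t (-‿cong t-x≈y)))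
    (λ {x} {y} x≈t-y → ≈-trans (+-congˡ t (-‿cong x≈t-y)) (≈-reflexive (sym (involutive t y))))
    where involutive : ∀ t x → x ≡ t - (t - x)
          involutive = solve-∀

  ∑ₚ-scale : ∀ {F : ℤ → ℤ} → F Preserves _≈_ ⟶ _≡_ → ∀ {a} → a ≉ 0ℤ → ∑ₚ[ x ] F (a * x) ≡ ∑ₚ F
  ∑ₚ-scale F-cong {a} a≉0 = ∑ₚ-reindex F-cong (a *_) (inverse a *_)
    (λ {x} {y} ax≈y → begin
      x                    ≡⟨ ℤ.*-identityˡ x ⟨
      1ℤ * x               ≈⟨ *-congʳ x (≈-sym (*-inverseˡ a≉0)) ⟩
      inverse a * a * x    ≡⟨ ℤ.*-assoc (inverse a) a x ⟩
      inverse a * (a * x)  ≈⟨ *-congˡ (inverse a) ax≈y ⟩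
      inverse a * y        ∎)
    (λ {x} {y} x≈a⁻¹y → begin
      a * x                ≈⟨ *-congˡ a x≈a⁻¹y ⟩
      a * (inverse a * y)  ≡⟨ ℤ.*-assoc a (inverse a) y ⟨
      a * inverse a * y    ≈⟨ *-congʳ y (*-inverseʳ a≉0) ⟩
      1ℤ * y               ≡⟨ ℤ.*-identityˡ y ⟩
      y                    ∎)
    where open ≈-Reasoning

  ∑ₚ-affine : ∀ {F : ℤ → ℤ} → F Preserves _≈_ ⟶ _≡_ → ∀ {a} → a ≉ 0ℤ → ∀ c → ∑ₚ[ x ] F (a * x + c) ≡ ∑ₚ F
  ∑ₚ-affine {F} F-cong a≉0 c =
    trans (∑ₚ-scale {λ y → F (y + c)} (λ x≈y → F-cong (+-congʳ c x≈y)) a≉0) (∑ₚ-shift F-cong c)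

module QuadraticCharacter {p : ℕ} (p-prime : Prime p) (2<p : 2 ℕ.< p) where

  open Residues p-prime

  2≉0 : + 2 ≉ 0ℤ
  2≉0 2≈0 = ℕ.<⇒≱ 2<p (ℕ.∣⇒≤ (≈0⇒∣ 2≈0))

  x²≈0⇒x≈0 : ∀ {x} → x * x ≈ 0ℤ → x ≈ 0ℤ
  x²≈0⇒x≈0 x²≈0 = [ id , id ]′ (*≈0⇒≈0⊎≈0 x²≈0)

  x≈-x⇒x≈0 : ∀ {x} → x ≈ - x → x ≈ 0ℤ
  x≈-x⇒x≈0 {x} x≈-x with *≈0⇒≈0⊎≈0 (≈-trans (≈-reflexive (twice x)) (≈⇒-≈0 x≈-x))
    where twice : ∀ x → + 2 * x ≡ x - - x
          twice = solve-∀
  ... | inj₁ 2≈0 = contradiction 2≈0 2≉0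
  ... | inj₂ x≈0 = x≈0

  x²≈y²⇒x≈±y : ∀ {x y} → x * x ≈ y * y → x ≈ y ⊎ x ≈ - y
  x²≈y²⇒x≈±y {x} {y} x²≈y² with *≈0⇒≈0⊎≈0 (≈-trans (≈-reflexive (factor x y)) (≈⇒-≈0 x²≈y²))
    where factor : ∀ x y → (x - y) * (x + y) ≡ x * x - y * y
          factor = solve-∀
  ... | inj₁ x-y≈0 = inj₁ (-≈0⇒≈ x-y≈0)
  ... | inj₂ x+y≈0 = inj₂ (-≈0⇒≈ (≈-trans (≈-reflexive (cong (_+_ x) (ℤ.neg-involutive y))) x+y≈0))

  data Residuosity (a : ℤ) : Set where
    null      : a ≈ 0ℤ → Residuosity a
    square    : a ≉ 0ℤ → ∀ x → x * x ≈ a → Residuosity a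
    nonsquare : a ≉ 0ℤ → (∀ x → x * x ≉ a) → Residuosity a

  private
    HasRootBelow-p : ℤ → Set
    HasRootBelow-p a = Any (λ n → p ℕ.∣ ∣ + n * + n - a ∣) (upTo p)

    root⇒any : ∀ {a} x → x * x ≈ a → HasRootBelow-p a
    root⇒any x x²≈a = lose (∈-upTo⁺ (residue<p x))
      (≈0⇒∣ (≈⇒-≈0 (≈-trans (*-cong (residue≈ x) (residue≈ x)) x²≈a)))

    any⇒root : ∀ {a} → HasRootBelow-p a → ∃ λ x → x * x ≈ a
    any⇒root any with Any.satisfied any
    ... | n , p∣n²-a = + n , -≈0⇒≈ (∣⇒≈0 p∣n²-a)

  private
    legendre : ∀ {A B : Set} → Dec A → Dec B → ℤ
    legendre a? b? = if does a? then 0ℤ else if does b? then 1ℤ else -1ℤ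

    roots? : ∀ a → Dec (HasRootBelow-p a)
    roots? a = any? (λ n → p ∣? ∣ + n * + n - a ∣) (upTo p)

    η≡legendre : ∀ a → η p a ≡ legendre (p ∣? ∣ a ∣) (roots? a)
    η≡legendre a = refl

    legendre-yes : ∀ {A B : Set} (a? : Dec A) (b? : Dec B) → A → legendre a? b? ≡ 0ℤ
    legendre-yes a? b? a rewrite dec-true a? a = refl

    legendre-no-yes : ∀ {A B : Set} (a? : Dec A) (b? : Dec B) → ¬ A → B → legendre a? b? ≡ 1ℤ
    legendre-no-yes a? b? ¬a b rewrite dec-false a? ¬a | dec-true b? b = refl

    legendre-no-no : ∀ {A B : Set} (a? : Dec A) (b? : Dec B) → ¬ A → ¬ B → legendre a? b? ≡ -1ℤ
    legendre-no-no a? b? ¬a ¬b rewrite dec-false a? ¬a | dec-false b? ¬b = refl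

  residuosity : ∀ a → Residuosity a
  residuosity a with a ≈? 0ℤ
  ... | yes a≈0 = null a≈0
  ... | no  a≉0 with roots? a
  ...   | yes any  = uncurry (square a≉0) (any⇒root any)
  ...   | no  ¬any = nonsquare a≉0 (λ x x²≈a → ¬any (root⇒any x x²≈a))

  η-null : ∀ {a} → a ≈ 0ℤ → η p a ≡ 0ℤ
  η-null {a} a≈0 = trans (η≡legendre a) (legendre-yes (p ∣? ∣ a ∣) (roots? a) (≈0⇒∣ a≈0))

  η-square : ∀ {a} → a ≉ 0ℤ → ∀ x → x * x ≈ a → η p a ≡ 1ℤ
  η-square {a} a≉0 x x²≈a = trans (η≡legendre a) (legendre-no-yes (p ∣? ∣ a ∣) (roots? a) (a≉0 ∘ ∣⇒≈0) (root⇒any x x²≈a))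

  η-nonsquare : ∀ {a} → a ≉ 0ℤ → (∀ x → x * x ≉ a) → η p a ≡ -1ℤ
  η-nonsquare {a} a≉0 no-root = trans (η≡legendre a) (legendre-no-no (p ∣? ∣ a ∣) (roots? a) (a≉0 ∘ ∣⇒≈0) (uncurry no-root ∘ any⇒root))

  η-cong : η p Preserves _≈_ ⟶ _≡_
  η-cong {a} {b} a≈b with residuosity a
  ... | null a≈0 = trans (η-null a≈0) (sym (η-null (≈-trans (≈-sym a≈b) a≈0)))
  ... | square a≉0 x x²≈a =
    trans (η-square a≉0 x x²≈a) (sym (η-square (a≉0 ∘ ≈-trans a≈b) x (≈-trans x²≈a a≈b)))
  ... | nonsquare a≉0 no-root =
    trans (η-nonsquare a≉0 no-root)
          (sym (η-nonsquare (a≉0 ∘ ≈-trans a≈b) (λ x x²≈b → no-root x (≈-trans x²≈b (≈-sym a≈b)))))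

  η-values : ∀ a → η p a ≡ 0ℤ ⊎ η p a ≡ 1ℤ ⊎ η p a ≡ -1ℤ
  η-values a with residuosity a
  ... | null a≈0                = inj₁ (η-null a≈0)
  ... | square a≉0 x x²≈a       = inj₂ (inj₁ (η-square a≉0 x x²≈a))
  ... | nonsquare a≉0 no-root   = inj₂ (inj₂ (η-nonsquare a≉0 no-root))

  root≉0 : ∀ {a x} → a ≉ 0ℤ → x * x ≈ a → x ≉ 0ℤ
  root≉0 a≉0 x²≈a x≈0 = a≉0 (≈-trans (≈-sym x²≈a) (*-cong x≈0 x≈0))

  δ-square≡δ+δ : ∀ {w y} → w ≉ 0ℤ → y * y ≈ w → ∀ x → δ (x * x) w ≡ δ x y + δ x (- y)
  δ-square≡δ+δ {w} {y} w≉0 y²≈w x with x ≈? y | x ≈? - y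
  ... | yes x≈y | yes x≈-y = contradiction (x≈-x⇒x≈0 (≈-trans (≈-sym x≈y) x≈-y)) (root≉0 w≉0 y²≈w)
  ... | yes x≈y | no  x≉-y =
    trans (δ-≈ (≈-trans (*-cong x≈y x≈y) y²≈w)) (sym (cong₂ _+_ (δ-≈ x≈y) (δ-≉ x≉-y)))
  ... | no  x≉y | yes x≈-y =
    trans (δ-≈ (≈-trans (*-cong x≈-y x≈-y) (≈-trans (≈-reflexive (neg-square y)) y²≈w)))
          (sym (cong₂ _+_ (δ-≉ x≉y) (δ-≈ x≈-y)))
    where neg-square : ∀ y → - y * - y ≡ y * y
          neg-square = solve-∀
  ... | no  x≉y | no  x≉-y =
    trans (δ-≉ (λ x²≈w → [ x≉y , x≉-y ]′ (x²≈y²⇒x≈±y (≈-trans x²≈w (≈-sym y²≈w)))))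
          (sym (cong₂ _+_ (δ-≉ x≉y) (δ-≉ x≉-y)))

  ∑ₚ-δ-square : ∀ w → ∑ₚ[ x ] δ (x * x) w ≡ 1ℤ + η p w
  ∑ₚ-δ-square w with residuosity w
  ... | null w≈0 = begin
    ∑ₚ[ x ] δ (x * x) w  ≡⟨ ∑ₚ-cong (λ x → δ-cong {x * x} {w} {x} {0ℤ}
                                       (λ x²≈w → x²≈0⇒x≈0 (≈-trans x²≈w w≈0))
                                       (λ x≈0 → ≈-trans (*-cong x≈0 x≈0) (≈-sym w≈0))) ⟩
    ∑ₚ[ x ] δ x 0ℤ       ≡⟨ ∑ₚ-δ 0ℤ ⟩
    1ℤ + 0ℤ              ≡⟨ cong (_+_ 1ℤ) (η-null w≈0) ⟨
    1ℤ + η p w           ∎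
    where open ≡-Reasoning
  ... | square w≉0 y y²≈w = begin
    ∑ₚ[ x ] δ (x * x) w                ≡⟨ ∑ₚ-cong (δ-square≡δ+δ {w} {y} w≉0 y²≈w) ⟩
    ∑ₚ[ x ] (δ x y + δ x (- y))        ≡⟨ ∑ₚ-+ (λ x → δ x y) (λ x → δ x (- y)) ⟩
    ∑ₚ[ x ] δ x y + ∑ₚ[ x ] δ x (- y)  ≡⟨ cong₂ _+_ (∑ₚ-δ y) (∑ₚ-δ (- y)) ⟩
    1ℤ + 1ℤ                            ≡⟨ cong (_+_ 1ℤ) (η-square w≉0 y y²≈w) ⟨
    1ℤ + η p w                         ∎
    where open ≡-Reasoning
  ... | nonsquare w≉0 no-root = begin
    ∑ₚ[ x ] δ (x * x) w  ≡⟨ ∑ₚ-cong (λ x → δ-≉ (no-root x)) ⟩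
    ∑ₚ[ x ] 0ℤ           ≡⟨ ∑ₚ-const 0ℤ ⟩
    + p * 0ℤ             ≡⟨ ℤ.*-zeroʳ (+ p) ⟩
    1ℤ + -1ℤ             ≡⟨ cong (_+_ 1ℤ) (η-nonsquare w≉0 no-root) ⟨
    1ℤ + η p w           ∎
    where open ≡-Reasoning

  ∑ₚ-η≡0 : ∑ₚ (η p) ≡ 0ℤ
  ∑ₚ-η≡0 = +-cancelˡ (+ p) (∑ₚ (η p)) 0ℤ (begin
    + p + ∑ₚ (η p)                ≡⟨ cong (_+ ∑ₚ (η p)) p≡∑ₚ1 ⟩
    ∑ₚ[ w ] 1ℤ + ∑ₚ (η p)         ≡⟨ ∑ₚ-+ (λ _ → 1ℤ) (η p) ⟨
    ∑ₚ[ w ] (1ℤ + η p w)          ≡⟨ ∑ₚ-cong ∑ₚ-δ-square ⟨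
    ∑ₚ[ w ] ∑ₚ[ x ] δ (x * x) w   ≡⟨ ∑ₚ-comm (λ w x → δ (x * x) w) ⟩
    ∑ₚ[ x ] ∑ₚ[ w ] δ (x * x) w   ≡⟨ ∑ₚ-cong (λ x → trans (∑ₚ-cong (δ-sym (x * x))) (∑ₚ-δ (x * x))) ⟩
    ∑ₚ[ x ] 1ℤ                    ≡⟨ p≡∑ₚ1 ⟨
    + p                           ≡⟨ ℤ.+-identityʳ (+ p) ⟨
    + p + 0ℤ                      ∎)
    where
    open ≡-Reasoning
    p≡∑ₚ1 : + p ≡ ∑ₚ[ x ] 1ℤ
    p≡∑ₚ1 = sym (trans (∑ₚ-const 1ℤ) (ℤ.*-identityʳ (+ p)))

  η-square-* : ∀ {x} b → x ≉ 0ℤ → η p (x * x * b) ≡ η p b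
  η-square-* {x} b x≉0 with residuosity b
  ... | null b≈0 =
    trans (η-null (≈-trans (*-congˡ (x * x) b≈0) (≈-reflexive (ℤ.*-zeroʳ (x * x))))) (sym (η-null b≈0))
  ... | square b≉0 y y²≈b =
    trans (η-square (*-≉0 (*-≉0 x≉0 x≉0) b≉0) (x * y)
                    (≈-trans (≈-reflexive (interchange x y)) (*-congˡ (x * x) y²≈b)))
          (sym (η-square b≉0 y y²≈b))
    where interchange : ∀ x y → x * y * (x * y) ≡ x * x * (y * y)
          interchange = solve-∀
  ... | nonsquare b≉0 no-root =
    trans (η-nonsquare (*-≉0 (*-≉0 x≉0 x≉0) b≉0) no-root′) (sym (η-nonsquare b≉0 no-root))
    where
    x⁻¹ = inverse x
    no-root′ : ∀ z → z * z ≉ x * x * b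
    no-root′ z z²≈x²b = no-root (z * x⁻¹) (begin
      z * x⁻¹ * (z * x⁻¹)              ≡⟨ interchange z x⁻¹ ⟩
      z * z * (x⁻¹ * x⁻¹)              ≈⟨ *-congʳ (x⁻¹ * x⁻¹) z²≈x²b ⟩
      x * x * b * (x⁻¹ * x⁻¹)          ≡⟨ regroup x b x⁻¹ ⟩
      x * x⁻¹ * (x * x⁻¹) * b          ≈⟨ *-congʳ b (*-cong (*-inverseʳ x≉0) (*-inverseʳ x≉0)) ⟩
      1ℤ * 1ℤ * b                      ≡⟨ ℤ.*-identityˡ b ⟩
      b                                ∎)
      where
      open ≈-Reasoning
      interchange : ∀ z y → z * y * (z * y) ≡ z * z * (y * y)
      interchange = solve-∀
      regroup : ∀ x b y → x * x * b * (y * y) ≡ x * y * (x * y) * b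
      regroup = solve-∀

  private
    isSquare isNonsquare : ℤ → ℤ
    isSquare c    = 𝟙 (η p c ℤ.≟ 1ℤ)
    isNonsquare c = 𝟙 (η p c ℤ.≟ -1ℤ)

    η≡isSquare-isNonsquare : ∀ c → η p c ≡ isSquare c - isNonsquare c
    η≡isSquare-isNonsquare c with η-values c
    ... | inj₁ η≡0        rewrite η≡0 = refl
    ... | inj₂ (inj₁ η≡1) rewrite η≡1 = refl
    ... | inj₂ (inj₂ η≡-1) rewrite η≡-1 = refl

    ∑ₚ-isSquare≡∑ₚ-isNonsquare : ∑ₚ isSquare ≡ ∑ₚ isNonsquare
    ∑ₚ-isSquare≡∑ₚ-isNonsquare = ℤ.i-j≡0⇒i≡j _ _ (begin
      ∑ₚ isSquare - ∑ₚ isNonsquare          ≡⟨ ∑ₚ-- isSquare isNonsquare ⟨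
      ∑ₚ[ c ] (isSquare c - isNonsquare c)  ≡⟨ ∑ₚ-cong η≡isSquare-isNonsquare ⟨
      ∑ₚ (η p)                              ≡⟨ ∑ₚ-η≡0 ⟩
      0ℤ                                    ∎)
      where open ≡-Reasoning

    1-η≥0 : ∀ x → 0ℤ ≤ 1ℤ - η p x
    1-η≥0 x with η-values x
    ... | inj₁ η≡0         = subst (λ e → 0ℤ ≤ 1ℤ - e) (sym η≡0) (ℤ.+≤+ ℕ.z≤n)
    ... | inj₂ (inj₁ η≡1)  = subst (λ e → 0ℤ ≤ 1ℤ - e) (sym η≡1) ℤ.≤-refl
    ... | inj₂ (inj₂ η≡-1) = subst (λ e → 0ℤ ≤ 1ℤ - e) (sym η≡-1) (ℤ.+≤+ ℕ.z≤n)

    η≡-1⇒≉0 : ∀ {a} → η p a ≡ -1ℤ → a ≉ 0ℤ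
    η≡-1⇒≉0 ηa≡-1 a≈0 = contradiction (trans (sym (η-null a≈0)) ηa≡-1) λ ()

    isNonsquare*η[ac]≡η[ac]+isSquare : ∀ {a} → η p a ≡ -1ℤ → ∀ c →
                                       isNonsquare c * η p (a * c) ≡ η p (a * c) + isSquare c
    isNonsquare*η[ac]≡η[ac]+isSquare {a} ηa≡-1 c with residuosity c
    ... | null c≈0 =
      subst (λ e → 𝟙 (e ℤ.≟ -1ℤ) * η p (a * c) ≡ η p (a * c) + 𝟙 (e ℤ.≟ 1ℤ)) (sym (η-null c≈0))
      (sym (trans (ℤ.+-identityʳ _) (η-null (≈-trans (*-congˡ a c≈0) (≈-reflexive (ℤ.*-zeroʳ a))))))
    ... | square c≉0 x x²≈c =
      subst (λ e → 𝟙 (e ℤ.≟ -1ℤ) * η p (a * c) ≡ η p (a * c) + 𝟙 (e ℤ.≟ 1ℤ)) (sym (η-square c≉0 x x²≈c))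
      (sym (begin
      η p (a * c) + 1ℤ      ≡⟨ cong (_+ 1ℤ) (η-cong (≈-trans (*-congˡ a (≈-sym x²≈c)) (≈-reflexive (ℤ.*-comm a (x * x))))) ⟩
      η p (x * x * a) + 1ℤ  ≡⟨ cong (_+ 1ℤ) (trans (η-square-* {x} a (root≉0 c≉0 x²≈c)) ηa≡-1) ⟩
      0ℤ                    ∎))
      where open ≡-Reasoning
    ... | nonsquare c≉0 no-root =
      subst (λ e → 𝟙 (e ℤ.≟ -1ℤ) * η p (a * c) ≡ η p (a * c) + 𝟙 (e ℤ.≟ 1ℤ)) (sym (η-nonsquare c≉0 no-root))
      (trans (ℤ.*-identityˡ _) (sym (ℤ.+-identityʳ _)))

    ∑ₚ-isNonsquare*[1-η[ac]]≡0 : ∀ {a} → η p a ≡ -1ℤ → ∑ₚ[ c ] (isNonsquare c * (1ℤ - η p (a * c))) ≡ 0ℤ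
    ∑ₚ-isNonsquare*[1-η[ac]]≡0 {a} ηa≡-1 = begin
      ∑ₚ[ c ] (isNonsquare c * (1ℤ - η p (a * c)))            ≡⟨ ∑ₚ-cong (λ c → distrib (isNonsquare c) (η p (a * c))) ⟩
      ∑ₚ[ c ] (isNonsquare c - isNonsquare c * η p (a * c))   ≡⟨ ∑ₚ-- isNonsquare (λ c → isNonsquare c * η p (a * c)) ⟩
      ∑ₚ isNonsquare - ∑ₚ[ c ] (isNonsquare c * η p (a * c))
        ≡⟨ cong (_-_ (∑ₚ isNonsquare)) (∑ₚ-cong (isNonsquare*η[ac]≡η[ac]+isSquare ηa≡-1)) ⟩
      ∑ₚ isNonsquare - ∑ₚ[ c ] (η p (a * c) + isSquare c)     ≡⟨ cong (_-_ (∑ₚ isNonsquare)) (∑ₚ-+ (λ c → η p (a * c)) isSquare) ⟩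
      ∑ₚ isNonsquare - (∑ₚ[ c ] η p (a * c) + ∑ₚ isSquare)
        ≡⟨ cong₂ (λ s t → ∑ₚ isNonsquare - (s + t)) ∑ₚη[ac]≡0 ∑ₚ-isSquare≡∑ₚ-isNonsquare ⟩
      ∑ₚ isNonsquare - (0ℤ + ∑ₚ isNonsquare)                  ≡⟨ cancel (∑ₚ isNonsquare) ⟩
      0ℤ                                                      ∎
      where
      open ≡-Reasoning
      ∑ₚη[ac]≡0 = trans (∑ₚ-scale η-cong (η≡-1⇒≉0 ηa≡-1)) ∑ₚ-η≡0
      distrib : ∀ s e → s * (1ℤ - e) ≡ s - s * e
      distrib = solve-∀
      cancel : ∀ s → s - (0ℤ + s) ≡ 0ℤ
      cancel = solve-∀

  -- Multiplication by a nonsquare sends the nonzero squares to nonsquares; as there are equally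
  -- many of each, counting forces it to send every nonsquare to a square.
  nonsquare-*-nonsquare : ∀ {a b} → η p a ≡ -1ℤ → η p b ≡ -1ℤ → η p (a * b) ≡ 1ℤ
  nonsquare-*-nonsquare {a} {b} ηa≡-1 ηb≡-1 = sym (ℤ.i-j≡0⇒i≡j 1ℤ (η p (a * b)) (begin
    1ℤ - η p (a * b)                ≡⟨ ℤ.*-identityˡ _ ⟨
    1ℤ * (1ℤ - η p (a * b))         ≡⟨ cong (λ s → s * (1ℤ - η p (a * b))) (𝟙-yes (η p b ℤ.≟ -1ℤ) ηb≡-1) ⟨
    F b                             ≡⟨ ∑ₚ-nonneg≡0⇒≡0 F-cong F≥0 (∑ₚ-isNonsquare*[1-η[ac]]≡0 ηa≡-1) b ⟩
    0ℤ                              ∎))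
    where
    open ≡-Reasoning
    F : ℤ → ℤ
    F c = isNonsquare c * (1ℤ - η p (a * c))
    F-cong : F Preserves _≈_ ⟶ _≡_
    F-cong c≈d = cong₂ (λ s t → 𝟙 (s ℤ.≟ -1ℤ) * (1ℤ - t)) (η-cong c≈d) (η-cong (*-congˡ a c≈d))
    F≥0 : ∀ c → 0ℤ ≤ F c
    F≥0 c = 0≤i⇒0≤j⇒0≤i*j (0≤𝟙 (η p c ℤ.≟ -1ℤ)) (1-η≥0 (a * c))

  η-* : ∀ a b → η p (a * b) ≡ η p a * η p b
  η-* a b with residuosity a | residuosity b
  ... | null a≈0 | _ =
    trans (η-null (≈-trans (*-congʳ b a≈0) (≈-reflexive (ℤ.*-zeroˡ b)))) (sym (cong (_* η p b) (η-null a≈0)))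
  ... | _ | null b≈0 =
    trans (η-null (≈-trans (*-congˡ a b≈0) (≈-reflexive (ℤ.*-zeroʳ a))))
          (sym (trans (cong (η p a *_) (η-null b≈0)) (ℤ.*-zeroʳ (η p a))))
  ... | square a≉0 x x²≈a | _ = begin
    η p (a * b)      ≡⟨ η-cong (*-congʳ b (≈-sym x²≈a)) ⟩
    η p (x * x * b)  ≡⟨ η-square-* {x} b (root≉0 a≉0 x²≈a) ⟩
    η p b            ≡⟨ ℤ.*-identityˡ (η p b) ⟨
    1ℤ * η p b       ≡⟨ cong (_* η p b) (η-square a≉0 x x²≈a) ⟨
    η p a * η p b    ∎
    where open ≡-Reasoning
  ... | nonsquare _ _ | square b≉0 y y²≈b = begin
    η p (a * b)      ≡⟨ η-cong (≈-trans (*-congˡ a (≈-sym y²≈b)) (≈-reflexive (ℤ.*-comm a (y * y)))) ⟩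
    η p (y * y * a)  ≡⟨ η-square-* {y} a (root≉0 b≉0 y²≈b) ⟩
    η p a            ≡⟨ ℤ.*-identityʳ (η p a) ⟨
    η p a * 1ℤ       ≡⟨ cong (η p a *_) (η-square b≉0 y y²≈b) ⟨
    η p a * η p b    ∎
    where open ≡-Reasoning
  ... | nonsquare a≉0 a-no-root | nonsquare b≉0 b-no-root =
    trans (nonsquare-*-nonsquare ηa≡-1 ηb≡-1) (sym (cong₂ _*_ ηa≡-1 ηb≡-1))
    where ηa≡-1 = η-nonsquare a≉0 a-no-root
          ηb≡-1 = η-nonsquare b≉0 b-no-root

  η²≡1 : ∀ {u} → u ≉ 0ℤ → η p u * η p u ≡ 1ℤ
  η²≡1 {u} u≉0 with residuosity u
  ... | null u≈0              = contradiction u≈0 u≉0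
  ... | square _ x x²≈u       = cong (λ e → e * e) (η-square u≉0 x x²≈u)
  ... | nonsquare _ no-root   = cong (λ e → e * e) (η-nonsquare u≉0 no-root)

  jacobi : ℤ → ℤ
  jacobi t = ∑ₚ[ u ] (η p u * η p (t - u))

  jacobi-cong : jacobi Preserves _≈_ ⟶ _≡_
  jacobi-cong {s} {t} s≈t = ∑ₚ-cong (λ u → cong (η p u *_) (η-cong (+-congʳ (- u) s≈t)))

  jacobi-0 : jacobi 0ℤ ≡ (+ p - 1ℤ) * η p -1ℤ
  jacobi-0 = trans (∑ₚ-by-cases at-0 off-0) (ℤ.+-identityˡ _)
    where
    open ≡-Reasoning
    at-0 : ∀ {u} → u ≈ 0ℤ → η p u * η p (0ℤ - u) ≡ 0ℤ
    at-0 {u} u≈0 = cong (_* η p (0ℤ - u)) (η-null u≈0)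
    0-u≡-1*u : ∀ u → 0ℤ - u ≡ -1ℤ * u
    0-u≡-1*u = solve-∀
    regroup : ∀ x e → x * (e * x) ≡ x * x * e
    regroup = solve-∀
    off-0 : ∀ {u} → u ≉ 0ℤ → η p u * η p (0ℤ - u) ≡ η p -1ℤ
    off-0 {u} u≉0 = begin
      η p u * η p (0ℤ - u)        ≡⟨ cong (λ x → η p u * η p x) (0-u≡-1*u u) ⟩
      η p u * η p (-1ℤ * u)       ≡⟨ cong (η p u *_) (η-* -1ℤ u) ⟩
      η p u * (η p -1ℤ * η p u)   ≡⟨ regroup (η p u) (η p -1ℤ) ⟩
      η p u * η p u * η p -1ℤ     ≡⟨ cong (_* η p -1ℤ) (η²≡1 u≉0) ⟩
      1ℤ * η p -1ℤ                ≡⟨ ℤ.*-identityˡ (η p -1ℤ) ⟩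
      η p -1ℤ                     ∎

  jacobi-scale : ∀ {t} → t ≉ 0ℤ → jacobi t ≡ jacobi 1ℤ
  jacobi-scale {t} t≉0 = trans (sym (∑ₚ-scale summand-cong t≉0)) (∑ₚ-cong pull-out-t)
    where
    open ≡-Reasoning
    summand-cong : (λ u → η p u * η p (t - u)) Preserves _≈_ ⟶ _≡_
    summand-cong u≈v = cong₂ _*_ (η-cong u≈v) (η-cong (+-congˡ t (-‿cong u≈v)))
    factor : ∀ t u → t - t * u ≡ t * (1ℤ - u)
    factor = solve-∀
    regroup : ∀ a b c → a * b * (a * c) ≡ a * a * (b * c)
    regroup = solve-∀
    pull-out-t : ∀ u → η p (t * u) * η p (t - t * u) ≡ η p u * η p (1ℤ - u)
    pull-out-t u = begin
      η p (t * u) * η p (t - t * u)         ≡⟨ cong₂ _*_ (η-* t u) (trans (cong (η p) (factor t u)) (η-* t (1ℤ - u))) ⟩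
      η p t * η p u * (η p t * η p (1ℤ - u)) ≡⟨ regroup (η p t) (η p u) (η p (1ℤ - u)) ⟩
      η p t * η p t * (η p u * η p (1ℤ - u)) ≡⟨ cong (_* (η p u * η p (1ℤ - u))) (η²≡1 t≉0) ⟩
      1ℤ * (η p u * η p (1ℤ - u))           ≡⟨ ℤ.*-identityˡ _ ⟩
      η p u * η p (1ℤ - u)                  ∎

  ∑ₚ-jacobi≡0 : ∑ₚ jacobi ≡ 0ℤ
  ∑ₚ-jacobi≡0 = begin
    ∑ₚ[ t ] ∑ₚ[ u ] (η p u * η p (t - u))    ≡⟨ ∑ₚ-comm (λ t u → η p u * η p (t - u)) ⟩
    ∑ₚ[ u ] ∑ₚ[ t ] (η p u * η p (t - u))    ≡⟨ ∑ₚ-cong (λ u → ∑ₚ-*ˡ (η p u) (λ t → η p (t - u))) ⟩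
    ∑ₚ[ u ] (η p u * ∑ₚ[ t ] η p (t - u))    ≡⟨ ∑ₚ-cong (λ u → cong (η p u *_) (trans (∑ₚ-shift η-cong (- u)) ∑ₚ-η≡0)) ⟩
    ∑ₚ[ u ] (η p u * 0ℤ)                     ≡⟨ ∑ₚ-cong (λ u → ℤ.*-zeroʳ (η p u)) ⟩
    ∑ₚ[ u ] 0ℤ                               ≡⟨ ∑ₚ-const 0ℤ ⟩
    + p * 0ℤ                                 ≡⟨ ℤ.*-zeroʳ (+ p) ⟩
    0ℤ                                       ∎
    where open ≡-Reasoning

  -- Summing jacobi t = jacobi 1 (t ≉ 0) over all t gives 0 = jacobi 0 + (p - 1) jacobi 1.
  jacobi-1 : jacobi 1ℤ ≡ - η p -1ℤ
  jacobi-1 = [ (λ p-1≡0 → contradiction (p≡1 p-1≡0) (ℕ.>⇒≢ (ℕ.<-trans (ℕ.s≤s (ℕ.s≤s ℕ.z≤n)) 2<p)))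
             , (λ η[-1]+J₁≡0 → trans (isolate (η p -1ℤ) (jacobi 1ℤ)) (trans (cong (_- η p -1ℤ) η[-1]+J₁≡0) (ℤ.+-identityˡ _)))
             ]′ (ℤ.i*j≡0⇒i≡0∨j≡0 (+ p - 1ℤ) [p-1]*[η[-1]+J₁]≡0)
    where
    open ≡-Reasoning
    p≡1 : + p - 1ℤ ≡ 0ℤ → p ≡ 1
    p≡1 p-1≡0 = ℤ.+-injective (ℤ.i-j≡0⇒i≡j (+ p) 1ℤ p-1≡0)
    isolate : ∀ e j → j ≡ (e + j) - e
    isolate = solve-∀
    [p-1]*[η[-1]+J₁]≡0 : (+ p - 1ℤ) * (η p -1ℤ + jacobi 1ℤ) ≡ 0ℤ
    [p-1]*[η[-1]+J₁]≡0 = begin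
      (+ p - 1ℤ) * (η p -1ℤ + jacobi 1ℤ)                 ≡⟨ ℤ.*-distribˡ-+ (+ p - 1ℤ) (η p -1ℤ) (jacobi 1ℤ) ⟩
      (+ p - 1ℤ) * η p -1ℤ + (+ p - 1ℤ) * jacobi 1ℤ      ≡⟨ cong (_+ (+ p - 1ℤ) * jacobi 1ℤ) jacobi-0 ⟨
      jacobi 0ℤ + (+ p - 1ℤ) * jacobi 1ℤ                 ≡⟨ ∑ₚ-by-cases jacobi-cong jacobi-scale ⟨
      ∑ₚ jacobi                                          ≡⟨ ∑ₚ-jacobi≡0 ⟩
      0ℤ                                                 ∎

  jacobi≡ : ∀ t → jacobi t ≡ η p -1ℤ * (+ p * δ t 0ℤ - 1ℤ)
  jacobi≡ t with t ≈? 0ℤ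
  ... | yes t≈0 = trans (jacobi-cong t≈0) (trans jacobi-0 (trans (reorder (+ p) (η p -1ℤ))
                    (cong (λ z → η p -1ℤ * (+ p * z - 1ℤ)) (sym (δ-≈ t≈0)))))
    where reorder : ∀ P e → (P - 1ℤ) * e ≡ e * (P * 1ℤ - 1ℤ)
          reorder = solve-∀
  ... | no  t≉0 = trans (jacobi-scale t≉0) (trans jacobi-1 (trans (reorder (+ p) (η p -1ℤ))
                    (cong (λ z → η p -1ℤ * (+ p * z - 1ℤ)) (sym (δ-≉ t≉0)))))
    where reorder : ∀ P e → - e ≡ e * (P * 0ℤ - 1ℤ)
          reorder = solve-∀

module QuadraticForms {p : ℕ} (p-prime : Prime p) (2<p : 2 ℕ.< p) where

  open Residues p-prime
  open QuadraticCharacter p-prime 2<p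

  ∑ₚ-δ[d*a²] : ∀ {d} → d ≉ 0ℤ → ∀ u → ∑ₚ[ a ] δ (d * (a * a)) u ≡ 1ℤ + η p d * η p u
  ∑ₚ-δ[d*a²] {d} d≉0 u = begin
    ∑ₚ[ a ] δ (d * (a * a)) u            ≡⟨ ∑ₚ-cong scale-both-sides ⟩
    ∑ₚ[ a ] δ (d * a * (d * a)) (d * u)  ≡⟨ ∑ₚ-scale {λ b → δ (b * b) (d * u)} (λ a≈b → δ-congˡ (d * u) (*-cong a≈b a≈b)) d≉0 ⟩
    ∑ₚ[ b ] δ (b * b) (d * u)            ≡⟨ ∑ₚ-δ-square (d * u) ⟩
    1ℤ + η p (d * u)                     ≡⟨ cong (_+_ 1ℤ) (η-* d u) ⟩
    1ℤ + η p d * η p u                   ∎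
    where
    open ≡-Reasoning
    regroup : ∀ d a → d * a * (d * a) ≡ d * (d * (a * a))
    regroup = solve-∀
    scale-both-sides : ∀ a → δ (d * (a * a)) u ≡ δ (d * a * (d * a)) (d * u)
    scale-both-sides a = δ-cong {d * (a * a)} {u} {d * a * (d * a)} {d * u}
      (λ da²≈u → ≈-trans (≈-reflexive (regroup d a)) (*-congˡ d da²≈u))
      (λ [da]²≈du → *-cancelˡ-≈ d≉0 (≈-trans (≈-reflexive (sym (regroup d a))) [da]²≈du))

  ∑ₚ-δ[t-d*a²] : ∀ {d} → d ≉ 0ℤ → ∀ t → ∑ₚ[ a ] δ (t - d * (a * a)) 0ℤ ≡ 1ℤ + η p d * η p t
  ∑ₚ-δ[t-d*a²] {d} d≉0 t = trans
    (∑ₚ-cong (λ a → δ-cong {t - d * (a * a)} {0ℤ} {d * (a * a)} {t} (≈-sym ∘′ -≈0⇒≈) (≈⇒-≈0 ∘′ ≈-sym)))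
    (∑ₚ-δ[d*a²] d≉0 t)

  ∑ₚ-η[t-d*a²] : ∀ {d} → d ≉ 0ℤ → ∀ t → ∑ₚ[ a ] η p (t - d * (a * a)) ≡ η p d * jacobi t
  ∑ₚ-η[t-d*a²] {d} d≉0 t = begin
    ∑ₚ[ a ] η p (t - d * (a * a))
      ≡⟨ ∑ₚ-fibres {λ v → η p (t - v)} (λ v≈w → η-cong (+-congˡ t (-‿cong v≈w))) (λ a → d * (a * a)) ⟩
    ∑ₚ[ v ] (η p (t - v) * ∑ₚ[ a ] δ (d * (a * a)) v)
      ≡⟨ ∑ₚ-cong (λ v → trans (cong (η p (t - v) *_) (∑ₚ-δ[d*a²] d≉0 v)) (distrib (η p (t - v)) (η p d) (η p v))) ⟩
    ∑ₚ[ v ] (η p (t - v) + η p d * (η p v * η p (t - v)))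
      ≡⟨ ∑ₚ-+ (λ v → η p (t - v)) (λ v → η p d * (η p v * η p (t - v))) ⟩
    ∑ₚ[ v ] η p (t - v) + ∑ₚ[ v ] (η p d * (η p v * η p (t - v)))
      ≡⟨ cong₂ _+_ (trans (∑ₚ-reflect η-cong t) ∑ₚ-η≡0) (∑ₚ-*ˡ (η p d) (λ v → η p v * η p (t - v))) ⟩
    0ℤ + η p d * jacobi t
      ≡⟨ ℤ.+-identityˡ _ ⟩
    η p d * jacobi t ∎
    where
    open ≡-Reasoning
    distrib : ∀ x e y → x * (1ℤ + e * y) ≡ x + e * (y * x)
    distrib = solve-∀

  record Shape (f : ℤ → ℤ) (A B C : ℤ) : Set where
    constructor shape
    field at : ∀ t → f t ≡ A + B * δ t 0ℤ + C * η p t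
  open Shape public

  Shape-≡ : ∀ {f A B C A′ B′ C′} → A ≡ A′ → B ≡ B′ → C ≡ C′ → Shape f A B C → Shape f A′ B′ C′
  Shape-≡ refl refl refl f-shape = f-shape

  Shape⇒cong : ∀ {f A B C} → Shape f A B C → f Preserves _≈_ ⟶ _≡_
  Shape⇒cong {f} {A} {B} {C} (shape f≡) {s} {t} s≈t = begin
    f s                                ≡⟨ f≡ s ⟩
    A + B * δ s 0ℤ + C * η p s         ≡⟨ cong₂ (λ x y → A + B * x + C * y) (δ-congˡ 0ℤ s≈t) (η-cong s≈t) ⟩
    A + B * δ t 0ℤ + C * η p t         ≡⟨ f≡ t ⟨
    f t                                ∎
    where open ≡-Reasoning

  Shape-at-0 : ∀ {f A B C} → Shape f A B C → f 0ℤ ≡ A + B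
  Shape-at-0 {f} {A} {B} {C} (shape f≡) =
    trans (f≡ 0ℤ) (trans (cong₂ (λ x y → A + B * x + C * y) (δ-≈ (≈-refl {0ℤ})) (η-null (≈-refl {0ℤ}))) (simplify A B C))
    where simplify : ∀ A B C → A + B * 1ℤ + C * 0ℤ ≡ A + B
          simplify = solve-∀

  -- If f counts the representations by a form Q, then addSquare d f counts those by Q ⊕ ⟨d⟩.
  addSquare : ℤ → (ℤ → ℤ) → ℤ → ℤ
  addSquare d f t = ∑ₚ[ a ] f (t - d * (a * a))

  addSquare-shape : ∀ {d f A B C} → d ≉ 0ℤ → Shape f A B C →
                    Shape (addSquare d f) (+ p * A + B - C * η p (- d)) (+ p * C * η p (- d)) (B * η p d)
  addSquare-shape {d} {f} {A} {B} {C} d≉0 (shape f≡) = shape λ t → begin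
    ∑ₚ[ a ] f (t - d * (a * a))
      ≡⟨ ∑ₚ-cong (λ a → f≡ (t - d * (a * a))) ⟩
    ∑ₚ[ a ] (A + B * δ (t - d * (a * a)) 0ℤ + C * η p (t - d * (a * a)))
      ≡⟨ ∑ₚ-+ (λ a → A + B * δ (t - d * (a * a)) 0ℤ) (λ a → C * η p (t - d * (a * a))) ⟩
    ∑ₚ[ a ] (A + B * δ (t - d * (a * a)) 0ℤ) + ∑ₚ[ a ] (C * η p (t - d * (a * a)))
      ≡⟨ cong₂ _+_ (∑ₚ-+ (λ _ → A) (λ a → B * δ (t - d * (a * a)) 0ℤ))
                   (∑ₚ-*ˡ C (λ a → η p (t - d * (a * a)))) ⟩
    ∑ₚ[ a ] A + ∑ₚ[ a ] (B * δ (t - d * (a * a)) 0ℤ) + C * ∑ₚ[ a ] η p (t - d * (a * a))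
      ≡⟨ cong₂ (λ x y → x + y + C * ∑ₚ[ a ] η p (t - d * (a * a)))
               (∑ₚ-const A) (∑ₚ-*ˡ B (λ a → δ (t - d * (a * a)) 0ℤ)) ⟩
    + p * A + B * ∑ₚ[ a ] δ (t - d * (a * a)) 0ℤ + C * ∑ₚ[ a ] η p (t - d * (a * a))
      ≡⟨ cong₂ (λ x y → + p * A + B * x + C * y) (∑ₚ-δ[t-d*a²] d≉0 t)
               (trans (∑ₚ-η[t-d*a²] d≉0 t) (cong (η p d *_) (jacobi≡ t))) ⟩
    + p * A + B * (1ℤ + η p d * η p t) + C * (η p d * (η p -1ℤ * (+ p * δ t 0ℤ - 1ℤ)))
      ≡⟨ expand (+ p) A B C (η p d) (η p t) (η p -1ℤ) (δ t 0ℤ) ⟩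
    + p * A + B - C * (η p -1ℤ * η p d) + + p * C * (η p -1ℤ * η p d) * δ t 0ℤ + B * η p d * η p t
      ≡⟨ cong (λ e → + p * A + B - C * e + + p * C * e * δ t 0ℤ + B * η p d * η p t) η[-1]η[d]≡η[-d] ⟩
    + p * A + B - C * η p (- d) + + p * C * η p (- d) * δ t 0ℤ + B * η p d * η p t
      ∎
    where
    open ≡-Reasoning
    η[-1]η[d]≡η[-d] : η p -1ℤ * η p d ≡ η p (- d)
    η[-1]η[d]≡η[-d] = trans (sym (η-* -1ℤ d)) (cong (η p) (ℤ.-1*i≡-i d))
    expand : ∀ P A B C ed et e₋₁ z →
             P * A + B * (1ℤ + ed * et) + C * (ed * (e₋₁ * (P * z - 1ℤ)))
             ≡ P * A + B - C * (e₋₁ * ed) + P * C * (e₋₁ * ed) * z + B * ed * et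
    expand = solve-∀

  addSquare-null : ∀ {d f A B C} → d ≈ 0ℤ → Shape f A B C → Shape (addSquare d f) (+ p * A) (+ p * B) (+ p * C)
  addSquare-null {d} {f} {A} {B} {C} d≈0 f-shape = shape λ t → begin
    ∑ₚ[ a ] f (t - d * (a * a))    ≡⟨ ∑ₚ-cong (λ a → Shape⇒cong f-shape (t-da²≈t {t} a)) ⟩
    ∑ₚ[ a ] f t                    ≡⟨ ∑ₚ-const (f t) ⟩
    + p * f t                      ≡⟨ cong (+ p *_) (at f-shape t) ⟩
    + p * (A + B * δ t 0ℤ + C * η p t) ≡⟨ distrib (+ p) A B C (δ t 0ℤ) (η p t) ⟩
    + p * A + + p * B * δ t 0ℤ + + p * C * η p t ∎
    where
    open ≡-Reasoning
    t-da²≈t : ∀ {t} a → t - d * (a * a) ≈ t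
    t-da²≈t {t} a = ≈-trans (+-congˡ t (-‿cong (≈-trans (*-congʳ (a * a) d≈0) (≈-reflexive (ℤ.*-zeroˡ (a * a))))))
                        (≈-reflexive (ℤ.+-identityʳ t))
    distrib : ∀ P A B C x y → P * (A + B * x + C * y) ≡ P * A + P * B * x + P * C * y
    distrib = solve-∀

  -- level n s q = #{x ∈ 𝔽ₚⁿ : ∑x = s, ∑x² = q} and reps n t = #{x ∈ 𝔽ₚⁿ : (∑x)² + ∑x² = t}.
  level : ℕ → ℤ → ℤ → ℤ
  level zero    s q = δ s 0ℤ * δ q 0ℤ
  level (suc n) s q = ∑ₚ[ a ] level n (s - a) (q - a * a)

  reps : ℕ → ℤ → ℤ
  reps n t = ∑ₚ[ s ] level n s (t - s * s)

  level-cong : ∀ n {s s′ q q′} → s ≈ s′ → q ≈ q′ → level n s q ≡ level n s′ q′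
  level-cong zero    s≈s′ q≈q′ = cong₂ _*_ (δ-congˡ 0ℤ s≈s′) (δ-congˡ 0ℤ q≈q′)
  level-cong (suc n) {s} {s′} {q} {q′} s≈s′ q≈q′ =
    ∑ₚ-cong (λ a → level-cong n (+-congʳ (- a) s≈s′) (+-congʳ (- (a * a)) q≈q′))

  -- x ↦ x + l·(1, …, 1) is a bijection of 𝔽ₚⁿ.
  level-translate : ∀ n s q l → level n (s + + n * l) (q + + 2 * l * s + + n * (l * l)) ≡ level n s q
  level-translate zero s q l with s ≈? 0ℤ
  ... | yes s≈0 = level-cong zero (≈-reflexive (drop-s s l)) (≈-trans (≈-reflexive (drop-q q l s)) q+2ls≈q)
    where
    drop-s : ∀ s l → s + 0ℤ * l ≡ s
    drop-s = solve-∀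
    drop-q : ∀ q l s → q + + 2 * l * s + 0ℤ * (l * l) ≡ q + + 2 * l * s
    drop-q = solve-∀
    q+2ls≈q : q + + 2 * l * s ≈ q
    q+2ls≈q = ≈-trans (+-congˡ q (*-congˡ (+ 2 * l) s≈0)) (≈-reflexive (trans (cong (_+_ q) (ℤ.*-zeroʳ (+ 2 * l))) (ℤ.+-identityʳ q)))
  ... | no  s≉0 = trans (cong (_* δ (q + + 2 * l * s + 0ℤ * (l * l)) 0ℤ) (δ-≉ (s≉0 ∘′ ≈-trans (≈-reflexive (sym (drop-s s l))))))
                        (sym (cong (_* δ q 0ℤ) (δ-≉ s≉0)))
    where
    drop-s : ∀ s l → s + 0ℤ * l ≡ s
    drop-s = solve-∀
  level-translate (suc n) s q l = begin
    ∑ₚ[ a ] level n (s′ - a) (q′ - a * a)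
      ≡⟨ ∑ₚ-shift (λ a≈b → level-cong n (+-congˡ s′ (-‿cong a≈b)) (+-congˡ q′ (-‿cong (*-cong a≈b a≈b)))) l ⟨
    ∑ₚ[ b ] level n (s′ - (b + l)) (q′ - (b + l) * (b + l))
      ≡⟨ ∑ₚ-cong (λ b → cong₂ (level n) (regroup-s s (+ n) l b) (regroup-q q (+ n) l s b)) ⟩
    ∑ₚ[ b ] level n (s - b + + n * l) (q - b * b + + 2 * l * (s - b) + + n * (l * l))
      ≡⟨ ∑ₚ-cong (λ b → level-translate n (s - b) (q - b * b) l) ⟩
    ∑ₚ[ b ] level n (s - b) (q - b * b)                ∎
    where
    open ≡-Reasoning
    s′ = s + + suc n * l
    q′ = q + + 2 * l * s + + suc n * (l * l)
    regroup-s : ∀ s n l b → s + (1ℤ + n) * l - (b + l) ≡ s - b + n * l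
    regroup-s = solve-∀
    regroup-q : ∀ q n l s b → q + + 2 * l * s + (1ℤ + n) * (l * l) - (b + l) * (b + l)
                              ≡ q - b * b + + 2 * l * (s - b) + n * (l * l)
    regroup-q = solve-∀

  ∑ₚ-level : ∀ n s → ∑ₚ[ q ] level (suc n) s q ≡ (+ p) ℤ.^ n
  ∑ₚ-level n s = trans (∑ₚ-comm (λ q a → level n (s - a) (q - a * a))) (∑ₚ-level′ n)
    where
    drop-shift : ∀ n a → ∑ₚ[ q ] level n (s - a) (q - a * a) ≡ ∑ₚ[ q ] level n (s - a) q
    drop-shift n a = ∑ₚ-shift {λ q → level n (s - a) q} (level-cong n ≈-refl) (- (a * a))
    ∑ₚ-level′ : ∀ n → ∑ₚ[ a ] ∑ₚ[ q ] level n (s - a) (q - a * a) ≡ (+ p) ℤ.^ n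
    ∑ₚ-level′ zero = begin
      ∑ₚ[ a ] ∑ₚ[ q ] (δ (s - a) 0ℤ * δ (q - a * a) 0ℤ)  ≡⟨ ∑ₚ-cong (λ a → drop-shift zero a) ⟩
      ∑ₚ[ a ] ∑ₚ[ q ] (δ (s - a) 0ℤ * δ q 0ℤ)
        ≡⟨ ∑ₚ-cong (λ a → trans (∑ₚ-*ˡ (δ (s - a) 0ℤ) (λ q → δ q 0ℤ)) (cong (δ (s - a) 0ℤ *_) (∑ₚ-δ 0ℤ))) ⟩
      ∑ₚ[ a ] (δ (s - a) 0ℤ * 1ℤ)
        ≡⟨ ∑ₚ-cong (λ a → trans (ℤ.*-identityʳ _) (δ-cong {s - a} {0ℤ} {a} {s} (≈-sym ∘′ -≈0⇒≈) (≈⇒-≈0 ∘′ ≈-sym))) ⟩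
      ∑ₚ[ a ] δ a s                                      ≡⟨ ∑ₚ-δ s ⟩
      1ℤ                                                 ∎
      where open ≡-Reasoning
    ∑ₚ-level′ (suc n) = begin
      ∑ₚ[ a ] ∑ₚ[ q ] level (suc n) (s - a) (q - a * a)  ≡⟨ ∑ₚ-cong (drop-shift (suc n)) ⟩
      ∑ₚ[ a ] ∑ₚ[ q ] level (suc n) (s - a) q            ≡⟨ ∑ₚ-cong (λ a → ∑ₚ-level n (s - a)) ⟩
      ∑ₚ[ a ] ((+ p) ℤ.^ n)                                  ≡⟨ ∑ₚ-const ((+ p) ℤ.^ n) ⟩
      (+ p) ℤ.^ suc n                                        ∎
      where open ≡-Reasoning

  level-0≡reps : ∀ n u → level (suc n) 0ℤ u ≡ reps n u
  level-0≡reps n u = trans (∑ₚ-cong (λ a → cong (λ x → level n (0ℤ - a) (u - x)) (negate-square a)))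
    (∑ₚ-reflect {λ b → level n b (u - b * b)} (λ b≈c → level-cong n b≈c (+-congˡ u (-‿cong (*-cong b≈c b≈c)))) 0ℤ)
    where negate-square : ∀ a → a * a ≡ (0ℤ - a) * (0ℤ - a)
          negate-square = solve-∀

  private
    translate-sum : ∀ N i → N * i ≈ 1ℤ → ∀ s → s + N * - (s * i) ≈ 0ℤ
    translate-sum N i Ni≈1 s = begin
      s + N * - (s * i)   ≡⟨ regroup s N i ⟩
      s - s * (N * i)     ≈⟨ +-congˡ s (-‿cong (*-congˡ s Ni≈1)) ⟩
      s - s * 1ℤ          ≡⟨ cancel s ⟩
      0ℤ                  ∎
      where
      open ≈-Reasoning
      regroup : ∀ s N i → s + N * - (s * i) ≡ s - s * (N * i)
      regroup = solve-∀
      cancel : ∀ s → s - s * 1ℤ ≡ 0ℤ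
      cancel = solve-∀

    translate-squares : ∀ N i → N * i ≈ 1ℤ → ∀ t s →
                        t - s * s + + 2 * - (s * i) * s + N * (- (s * i) * - (s * i)) ≈ t - (1ℤ + N) * i * (s * s)
    translate-squares N i Ni≈1 t s = begin
      t - s * s + + 2 * - (s * i) * s + N * (- (s * i) * - (s * i))
        ≡⟨ regroup₁ t s N i ⟩
      t - s * s - + 2 * (s * s * i) + s * s * i * (N * i)
        ≈⟨ +-congˡ (t - s * s - + 2 * (s * s * i)) (*-congˡ (s * s * i) Ni≈1) ⟩
      t - s * s - + 2 * (s * s * i) + s * s * i * 1ℤ
        ≡⟨ regroup₂ t s i ⟩
      t - (1ℤ * (s * s) + i * (s * s))
        ≈⟨ +-congˡ t (-‿cong (+-congʳ (i * (s * s)) (*-congʳ (s * s) Ni≈1))) ⟨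
      t - (N * i * (s * s) + i * (s * s))
        ≡⟨ regroup₃ t s N i ⟩
      t - (1ℤ + N) * i * (s * s) ∎
      where
      open ≈-Reasoning
      regroup₁ : ∀ t s N i → t - s * s + + 2 * - (s * i) * s + N * (- (s * i) * - (s * i))
                             ≡ t - s * s - + 2 * (s * s * i) + s * s * i * (N * i)
      regroup₁ = solve-∀
      regroup₂ : ∀ t s i → t - s * s - + 2 * (s * s * i) + s * s * i * 1ℤ ≡ t - (1ℤ * (s * s) + i * (s * s))
      regroup₂ = solve-∀
      regroup₃ : ∀ t s N i → t - (N * i * (s * s) + i * (s * s)) ≡ t - (1ℤ + N) * i * (s * s)
      regroup₃ = solve-∀

  -- Completing the square: translating by l = -s/(n+1) makes the coordinate sum vanish, and the
  -- new variable s then enters the form with coefficient (n+2)/(n+1).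
  reps-suc : ∀ n → + suc n ≉ 0ℤ → ∀ t → reps (suc n) t ≡ addSquare (+ suc (suc n) * inverse (+ suc n)) (reps n) t
  reps-suc n n+1≉0 t = ∑ₚ-cong λ s → begin
    level (suc n) s (t - s * s)
      ≡⟨ level-translate (suc n) s (t - s * s) (- (s * i)) ⟨
    level (suc n) (s + + suc n * - (s * i)) (t - s * s + + 2 * - (s * i) * s + + suc n * (- (s * i) * - (s * i)))
      ≡⟨ level-cong (suc n) (translate-sum (+ suc n) i Ni≈1 s) (translate-squares (+ suc n) i Ni≈1 t s) ⟩
    level (suc n) 0ℤ (t - + suc (suc n) * i * (s * s))
      ≡⟨ level-0≡reps n (t - + suc (suc n) * i * (s * s)) ⟩
    reps n (t - + suc (suc n) * i * (s * s)) ∎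
    where
    open ≡-Reasoning
    i = inverse (+ suc n)
    Ni≈1 = *-inverseʳ n+1≉0

  private
    translate-squares-degenerate : ∀ N → N ≈ 0ℤ → ∀ {s} → s ≉ 0ℤ → ∀ q q′ → let l = (q′ - q) * inverse (+ 2 * s) in
                                   q + + 2 * l * s + N * (l * l) ≈ q′
    translate-squares-degenerate N N≈0 {s} s≉0 q q′ = begin
      q + + 2 * l * s + N * (l * l)                ≈⟨ +-congˡ (q + + 2 * l * s) (*-congʳ (l * l) N≈0) ⟩
      q + + 2 * l * s + 0ℤ * (l * l)               ≡⟨ regroup q q′ (inverse (+ 2 * s)) s ⟩
      q + (q′ - q) * (+ 2 * s * inverse (+ 2 * s)) ≈⟨ +-congˡ q (*-congˡ (q′ - q) (*-inverseʳ (*-≉0 2≉0 s≉0))) ⟩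
      q + (q′ - q) * 1ℤ                            ≡⟨ cancel q q′ ⟩
      q′                                           ∎
      where
      open ≈-Reasoning
      l = (q′ - q) * inverse (+ 2 * s)
      regroup : ∀ q q′ i s → q + + 2 * ((q′ - q) * i) * s + 0ℤ * (((q′ - q) * i) * ((q′ - q) * i))
                             ≡ q + (q′ - q) * (+ 2 * s * i)
      regroup = solve-∀
      cancel : ∀ q q′ → q + (q′ - q) * 1ℤ ≡ q′
      cancel = solve-∀

  -- If p ∣ n, translating by l·(1, …, 1) fixes ∑x = s and adds 2ls to ∑x², so for s ≉ 0 every q is hit equally often.
  level-degenerate : ∀ m → + suc (suc m) ≈ 0ℤ → ∀ {s} → s ≉ 0ℤ → ∀ q → level (suc (suc m)) s q ≡ (+ p) ℤ.^ m
  level-degenerate m N≈0 {s} s≉0 q = ℤ.*-cancelˡ-≡ (+ p) (level n s q) ((+ p) ℤ.^ m) (begin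
    + p * level n s q          ≡⟨ ∑ₚ-const (level n s q) ⟨
    ∑ₚ[ q′ ] level n s q       ≡⟨ ∑ₚ-cong level-const ⟩
    ∑ₚ[ q′ ] level n s q′      ≡⟨ ∑ₚ-level (suc m) s ⟩
    (+ p) ℤ.^ suc m              ∎)
    where
    open ≡-Reasoning
    n = suc (suc m)
    level-const : ∀ q′ → level n s q ≡ level n s q′
    level-const q′ = trans (sym (level-translate n s q l)) (level-cong n s+Nl≈s q+2ls+Nl²≈q′)
      where
      l = (q′ - q) * inverse (+ 2 * s)
      s+Nl≈s : s + + n * l ≈ s
      s+Nl≈s = ≈-trans (+-congˡ s (≈-trans (*-congʳ l N≈0) (≈-reflexive (ℤ.*-zeroˡ l)))) (≈-reflexive (ℤ.+-identityʳ s))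
      q+2ls+Nl²≈q′ : q + + 2 * l * s + + n * (l * l) ≈ q′
      q+2ls+Nl²≈q′ = translate-squares-degenerate (+ n) N≈0 s≉0 q q′

  reps-degenerate : ∀ m → + suc (suc m) ≈ 0ℤ → ∀ t → reps (suc (suc m)) t ≡ reps (suc m) t + (+ p - 1ℤ) * (+ p) ℤ.^ m
  reps-degenerate m N≈0 t = ∑ₚ-by-cases at-0 (λ {s} s≉0 → level-degenerate m N≈0 s≉0 (t - s * s))
    where
    at-0 : ∀ {s} → s ≈ 0ℤ → level (suc (suc m)) s (t - s * s) ≡ reps (suc m) t
    at-0 {s} s≈0 = trans (level-cong (suc (suc m)) s≈0 t-s²≈t) (level-0≡reps (suc m) t)
      where t-s²≈t = ≈-trans (+-congˡ t (-‿cong (*-cong s≈0 s≈0))) (≈-reflexive (ℤ.+-identityʳ t))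

  Shape-≗ : ∀ {f g A B C} → (∀ t → f t ≡ g t) → Shape g A B C → Shape f A B C
  Shape-≗ f≗g (shape g≡) = shape λ t → trans (f≗g t) (g≡ t)

  reps-0-shape : Shape (reps 0) 0ℤ 1ℤ 0ℤ
  reps-0-shape = shape λ t → begin
    ∑ₚ[ s ] (δ s 0ℤ * δ (t - s * s) 0ℤ)
      ≡⟨ ∑ₚ-δ-* {λ s → δ (t - s * s) 0ℤ} (λ s≈s′ → δ-congˡ 0ℤ (+-congˡ t (-‿cong (*-cong s≈s′ s≈s′)))) 0ℤ ⟩
    δ (t - 0ℤ * 0ℤ) 0ℤ                   ≡⟨ δ-congˡ 0ℤ (≈-reflexive (ℤ.+-identityʳ t)) ⟩
    δ t 0ℤ                               ≡⟨ only-δ (δ t 0ℤ) (η p t) ⟩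
    0ℤ + 1ℤ * δ t 0ℤ + 0ℤ * η p t        ∎
    where
    open ≡-Reasoning
    only-δ : ∀ x y → x ≡ 0ℤ + 1ℤ * x + 0ℤ * y
    only-δ = solve-∀

  η-*-inverse : ∀ {y} → y ≉ 0ℤ → ∀ x → η p (x * inverse y) ≡ η p (x * y)
  η-*-inverse {y} y≉0 x = trans (sym (η-square-* {y} (x * inverse y) y≉0)) (η-cong y²[xy⁻¹]≈xy)
    where
    regroup : ∀ y x i → y * y * (x * i) ≡ x * y * (y * i)
    regroup = solve-∀
    y²[xy⁻¹]≈xy : y * y * (x * inverse y) ≈ x * y
    y²[xy⁻¹]≈xy = ≈-trans (≈-reflexive (regroup y x (inverse y)))
                          (≈-trans (*-congˡ (x * y) (*-inverseʳ y≉0)) (≈-reflexive (ℤ.*-identityʳ (x * y))))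

  η-*-common : ∀ {D} → D ≉ 0ℤ → ∀ a b → η p (a * D) * η p (b * D) ≡ η p (a * b)
  η-*-common {D} D≉0 a b = begin
    η p (a * D) * η p (b * D)   ≡⟨ η-* (a * D) (b * D) ⟨
    η p (a * D * (b * D))       ≡⟨ cong (η p) (regroup a b D) ⟩
    η p (D * D * (a * b))       ≡⟨ η-square-* {D} (a * b) D≉0 ⟩
    η p (a * b)                 ∎
    where
    open ≡-Reasoning
    regroup : ∀ a b D → a * D * (b * D) ≡ D * D * (a * b)
    regroup = solve-∀

  shape-step : ∀ n {A B C} → + suc n ≉ 0ℤ → + suc (suc n) ≉ 0ℤ → Shape (reps n) A B C →
               let D₁ = + suc n; D₂ = + suc (suc n) in
               Shape (reps (suc n)) (+ p * A + B - C * η p (- D₂ * D₁)) (+ p * C * η p (- D₂ * D₁)) (B * η p (D₂ * D₁))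
  shape-step n {A} {B} {C} D₁≉0 D₂≉0 reps-shape =
    Shape-≡ (cong (λ e → + p * A + B - C * e) η[-d]) (cong (λ e → + p * C * e) η[-d]) (cong (B *_) (η-*-inverse D₁≉0 D₂))
      (Shape-≗ (reps-suc n D₁≉0) (addSquare-shape d≉0 reps-shape))
    where
    D₁ = + suc n
    D₂ = + suc (suc n)
    d = D₂ * inverse D₁
    d≉0 : d ≉ 0ℤ
    d≉0 = *-≉0 D₂≉0 (λ i≈0 → 1≉0 (≈-trans (≈-sym (*-inverseʳ D₁≉0)) (≈-trans (*-congˡ D₁ i≈0) (≈-reflexive (ℤ.*-zeroʳ D₁)))))
    η[-d] : η p (- d) ≡ η p (- D₂ * D₁)
    η[-d] = trans (cong (η p) (ℤ.neg-distribˡ-* D₂ (inverse D₁))) (η-*-inverse D₁≉0 (- D₂))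

  shape-step-null : ∀ n {A B C} → + suc n ≉ 0ℤ → + suc (suc n) ≈ 0ℤ → Shape (reps n) A B C →
                    Shape (reps (suc n)) (+ p * A) (+ p * B) (+ p * C)
  shape-step-null n D₁≉0 D₂≈0 reps-shape =
    Shape-≗ (reps-suc n D₁≉0) (addSquare-null d≈0 reps-shape)
    where
    d≈0 : + suc (suc n) * inverse (+ suc n) ≈ 0ℤ
    d≈0 = ≈-trans (*-congʳ (inverse (+ suc n)) D₂≈0) (≈-reflexive (ℤ.*-zeroˡ (inverse (+ suc n))))

  shape-step-degenerate : ∀ m {A B C} → + suc (suc m) ≈ 0ℤ → Shape (reps (suc m)) A B C →
                          Shape (reps (suc (suc m))) (A + (+ p - 1ℤ) * (+ p) ℤ.^ m) B C
  shape-step-degenerate m {A} {B} {C} D≈0 (shape reps≡) = shape λ t →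
    trans (reps-degenerate m D≈0 t) (trans (cong (_+ (+ p - 1ℤ) * (+ p) ℤ.^ m) (reps≡ t)) (reorder A B C _ _ _))
    where reorder : ∀ A B C x y z → A + B * x + C * y + z ≡ A + z + B * x + C * y
          reorder = solve-∀

double : ℕ → ℕ
double zero    = zero
double (suc j) = suc (suc (double j))

data Parity : ℕ → Set where
  even : ∀ j → Parity (double j)
  odd  : ∀ j → Parity (suc (double j))

parity : ∀ n → Parity n
parity zero = even 0
parity (suc n) with parity n
... | even j = odd j
... | odd  j = even (suc j)

double≡*2 : ∀ j → double j ≡ j ℕ.* 2
double≡*2 zero    = refl
double≡*2 (suc j) = cong (λ n → suc (suc n)) (double≡*2 j)

double/2≡id : ∀ j → double j ℕ./ 2 ≡ j
double/2≡id j = trans (cong (ℕ._/ 2) (double≡*2 j)) (ℕ.m*n/n≡m j 2)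

double%2≡0 : ∀ j → double j ℕ.% 2 ≡ 0
double%2≡0 zero    = refl
double%2≡0 (suc j) = double%2≡0 j

suc-double%2≡1 : ∀ j → suc (double j) ℕ.% 2 ≡ 1
suc-double%2≡1 zero    = refl
suc-double%2≡1 (suc j) = suc-double%2≡1 j

module RepresentationShapes {p : ℕ} (p-prime : Prime p) (2<p : 2 ℕ.< p) where

  open Residues p-prime
  open QuadraticCharacter p-prime 2<p
  open QuadraticForms p-prime 2<p

  σ : ℕ → ℤ
  σ j = -1ℤ ℤ.^ j

  η-*-≈0 : ∀ s {D} → D ≈ 0ℤ → η p (s * D) ≡ 0ℤ
  η-*-≈0 s D≈0 = η-null (≈-trans (*-congˡ s D≈0) (≈-reflexive (ℤ.*-zeroʳ s)))

  η-*-1+≈0 : ∀ s {D} → D ≈ 0ℤ → η p (s * (1ℤ + D)) ≡ η p s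
  η-*-1+≈0 s {D} D≈0 = η-cong (≈-trans (*-congˡ s (+-congˡ 1ℤ D≈0)) (≈-reflexive (ℤ.*-identityʳ s)))

  η-*-≈-1 : ∀ s {D} → 1ℤ + D ≈ 0ℤ → η p (s * D) ≡ η p (-1ℤ * s)
  η-*-≈-1 s {D} 1+D≈0 = η-cong (begin
    s * D                 ≡⟨ regroup s D ⟩
    s * (-1ℤ + (1ℤ + D))  ≈⟨ *-congˡ s (+-congˡ -1ℤ 1+D≈0) ⟩
    s * (-1ℤ + 0ℤ)        ≡⟨ finish s ⟩
    -1ℤ * s               ∎)
    where
    open ≈-Reasoning
    regroup : ∀ s D → s * D ≡ s * (-1ℤ + (1ℤ + D))
    regroup = solve-∀
    finish : ∀ s → s * (-1ℤ + 0ℤ) ≡ -1ℤ * s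
    finish = solve-∀

  1+≈0⇒≉0 : ∀ {D} → D ≈ 0ℤ → 1ℤ + D ≉ 0ℤ
  1+≈0⇒≉0 {D} D≈0 1+D≈0 = 1≉0 (≈-trans (≈-reflexive (sym (ℤ.+-identityʳ 1ℤ))) (≈-trans (+-congˡ 1ℤ (≈-sym D≈0)) 1+D≈0))

  -- Closed forms of reps n for n = 2j + 1 and n = 2j + 2; D = n + 1 is the discriminant of the form
  -- and z records whether p divides it.
  OddShape : ℕ → Set
  OddShape j = Shape (reps (suc (double j)))
                     ((+ p) ℤ.^ double j - z * (+ p) ℤ.^ j * ε) (z * (+ p) ℤ.^ suc j * ε) ((+ p) ℤ.^ j * η p (σ j * D))
    where
    D = + suc (suc (double j))
    z = δ D 0ℤ
    ε = η p (σ (suc j))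

  EvenShape : ℕ → Set
  EvenShape j = Shape (reps (suc (suc (double j))))
                      ((+ p) ℤ.^ suc (double j) - (+ p) ℤ.^ j * ε) ((+ p) ℤ.^ suc j * ε) (z * (+ p) ℤ.^ suc j * η p (σ (suc j)))
    where
    D = + suc (suc (suc (double j)))
    z = δ D 0ℤ
    ε = η p (σ (suc j) * D)

  odd-shape-0 : OddShape 0
  odd-shape-0 = Shape-≡ (trans (A≡ (+ p) (η p (- + 2 * + 1)) ε) (cong (λ z → 1ℤ - z * 1ℤ * ε) (sym z≡0)))
                        (trans (B≡ (+ p) (η p (- + 2 * + 1)) ε) (cong (λ z → z * (+ p) ℤ.^ 1 * ε) (sym z≡0)))
                        refl
                        (shape-step 0 1≉0 2≉0 reps-0-shape)
    where
    ε = η p (σ 1)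
    z≡0 : δ (+ 2) 0ℤ ≡ 0ℤ
    z≡0 = δ-≉ 2≉0
    A≡ : ∀ P e ε → P * 0ℤ + 1ℤ - 0ℤ * e ≡ 1ℤ - 0ℤ * 1ℤ * ε
    A≡ = solve-∀
    B≡ : ∀ P e ε → P * 0ℤ * e ≡ 0ℤ * (P * 1ℤ) * ε
    B≡ = solve-∀

  even-shape-degenerate : ∀ j → + suc (suc (double j)) ≈ 0ℤ → OddShape j → EvenShape j
  even-shape-degenerate j D₁≈0 shape-j = Shape-≡ A≡ B≡ C≡ (shape-step-degenerate (double j) D₁≈0 shape-j)
    where
    X = (+ p) ℤ.^ double j
    Y = (+ p) ℤ.^ j
    ε₁ = η p (σ (suc j))
    D₂ = + suc (suc (suc (double j)))
    ε₂≡ε₁ : η p (σ (suc j) * D₂) ≡ ε₁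
    ε₂≡ε₁ = η-*-1+≈0 (σ (suc j)) D₁≈0
    z₁≡1 = δ-≈ D₁≈0
    A≡ : X - δ (+ suc (suc (double j))) 0ℤ * Y * ε₁ + (+ p - 1ℤ) * X ≡ + p * X - Y * η p (σ (suc j) * D₂)
    A≡ = trans (cong (λ z → X - z * Y * ε₁ + (+ p - 1ℤ) * X) z₁≡1)
               (trans (ring (+ p) X Y ε₁) (cong (λ e → + p * X - Y * e) (sym ε₂≡ε₁)))
      where ring : ∀ P X Y e → X - 1ℤ * Y * e + (P - 1ℤ) * X ≡ P * X - Y * e
            ring = solve-∀
    B≡ : δ (+ suc (suc (double j))) 0ℤ * (+ p * Y) * ε₁ ≡ + p * Y * η p (σ (suc j) * D₂)
    B≡ = trans (cong (λ z → z * (+ p * Y) * ε₁) z₁≡1)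
               (trans (cong (_* ε₁) (ℤ.*-identityˡ (+ p * Y))) (cong (λ e → + p * Y * e) (sym ε₂≡ε₁)))
    C≡ : Y * η p (σ j * + suc (suc (double j))) ≡ δ D₂ 0ℤ * (+ p * Y) * ε₁
    C≡ = trans (cong (Y *_) (η-*-≈0 (σ j) D₁≈0))
               (trans (ℤ.*-zeroʳ Y) (cong (λ z → z * (+ p * Y) * ε₁) (sym (δ-≉ (1+≈0⇒≉0 D₁≈0)))))

  even-shape-null : ∀ j → + suc (suc (double j)) ≉ 0ℤ → + suc (suc (suc (double j))) ≈ 0ℤ → OddShape j → EvenShape j
  even-shape-null j D₁≉0 D₂≈0 shape-j = Shape-≡ A≡ B≡ C≡ (shape-step-null (suc (double j)) D₁≉0 D₂≈0 shape-j)
    where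
    X = (+ p) ℤ.^ double j
    Y = (+ p) ℤ.^ j
    ε₁ = η p (σ (suc j))
    D₁ = + suc (suc (double j))
    D₂ = + suc (suc (suc (double j)))
    z₁≡0 = δ-≉ D₁≉0
    ε₂≡0 : η p (σ (suc j) * D₂) ≡ 0ℤ
    ε₂≡0 = η-*-≈0 (σ (suc j)) D₂≈0
    A≡ : + p * (X - δ D₁ 0ℤ * Y * ε₁) ≡ + p * X - Y * η p (σ (suc j) * D₂)
    A≡ = trans (cong (λ z → + p * (X - z * Y * ε₁)) z₁≡0)
               (trans (ring (+ p) X Y ε₁) (cong (λ e → + p * X - Y * e) (sym ε₂≡0)))
      where ring : ∀ P X Y e → P * (X - 0ℤ * Y * e) ≡ P * X - Y * 0ℤ
            ring = solve-∀
    B≡ : + p * (δ D₁ 0ℤ * (+ p * Y) * ε₁) ≡ + p * Y * η p (σ (suc j) * D₂)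
    B≡ = trans (cong (λ z → + p * (z * (+ p * Y) * ε₁)) z₁≡0)
               (trans (ring (+ p) Y ε₁) (cong (λ e → + p * Y * e) (sym ε₂≡0)))
      where ring : ∀ P Y e → P * (0ℤ * (P * Y) * e) ≡ P * Y * 0ℤ
            ring = solve-∀
    C≡ : + p * (Y * η p (σ j * D₁)) ≡ δ D₂ 0ℤ * (+ p * Y) * ε₁
    C≡ = trans (cong (λ e → + p * (Y * e)) (η-*-≈-1 (σ j) D₂≈0))
               (trans (ring (+ p) Y ε₁) (cong (λ z → z * (+ p * Y) * ε₁) (sym (δ-≈ D₂≈0))))
      where ring : ∀ P Y e → P * (Y * e) ≡ 1ℤ * (P * Y) * e
            ring = solve-∀

  even-shape-generic : ∀ j → + suc (suc (double j)) ≉ 0ℤ → + suc (suc (suc (double j))) ≉ 0ℤ → OddShape j → EvenShape j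
  even-shape-generic j D₁≉0 D₂≉0 shape-j = Shape-≡ A≡ B≡ C≡ (shape-step (suc (double j)) D₁≉0 D₂≉0 shape-j)
    where
    X = (+ p) ℤ.^ double j
    Y = (+ p) ℤ.^ j
    ε₁ = η p (σ (suc j))
    D₁ = + suc (suc (double j))
    D₂ = + suc (suc (suc (double j)))
    z₁≡0 = δ-≉ D₁≉0
    η₁η₂≡ε₂ : η p (σ j * D₁) * η p (- D₂ * D₁) ≡ η p (σ (suc j) * D₂)
    η₁η₂≡ε₂ = trans (η-*-common D₁≉0 (σ j) (- D₂)) (cong (η p) (regroup (σ j) D₂))
      where regroup : ∀ s D → s * - D ≡ -1ℤ * s * D
            regroup = solve-∀
    A≡ : + p * (X - δ D₁ 0ℤ * Y * ε₁) + δ D₁ 0ℤ * (+ p * Y) * ε₁ - Y * η p (σ j * D₁) * η p (- D₂ * D₁)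
         ≡ + p * X - Y * η p (σ (suc j) * D₂)
    A≡ = trans (cong (λ z → + p * (X - z * Y * ε₁) + z * (+ p * Y) * ε₁ - Y * η p (σ j * D₁) * η p (- D₂ * D₁)) z₁≡0)
               (trans (ring (+ p) X Y ε₁ (η p (σ j * D₁)) (η p (- D₂ * D₁))) (cong (λ e → + p * X - Y * e) η₁η₂≡ε₂))
      where ring : ∀ P X Y e a b → P * (X - 0ℤ * Y * e) + 0ℤ * (P * Y) * e - Y * a * b ≡ P * X - Y * (a * b)
            ring = solve-∀
    B≡ : + p * (Y * η p (σ j * D₁)) * η p (- D₂ * D₁) ≡ + p * Y * η p (σ (suc j) * D₂)
    B≡ = trans (ring (+ p) Y (η p (σ j * D₁)) (η p (- D₂ * D₁))) (cong (+ p * Y *_) η₁η₂≡ε₂)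
      where ring : ∀ P Y a b → P * (Y * a) * b ≡ P * Y * (a * b)
            ring = solve-∀
    C≡ : δ D₁ 0ℤ * (+ p * Y) * ε₁ * η p (D₂ * D₁) ≡ δ D₂ 0ℤ * (+ p * Y) * ε₁
    C≡ = trans (cong (λ z → z * (+ p * Y) * ε₁ * η p (D₂ * D₁)) z₁≡0)
               (trans (ring (+ p) Y ε₁ (η p (D₂ * D₁))) (cong (λ z → z * (+ p * Y) * ε₁) (sym (δ-≉ D₂≉0))))
      where ring : ∀ P Y e f → 0ℤ * (P * Y) * e * f ≡ 0ℤ * (P * Y) * e
            ring = solve-∀

  even-shape : ∀ j → OddShape j → EvenShape j
  even-shape j with + suc (suc (double j)) ≈? 0ℤ | + suc (suc (suc (double j))) ≈? 0ℤ
  ... | yes D₁≈0 | _        = even-shape-degenerate j D₁≈0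
  ... | no D₁≉0  | yes D₂≈0 = even-shape-null j D₁≉0 D₂≈0
  ... | no D₁≉0  | no D₂≉0  = even-shape-generic j D₁≉0 D₂≉0

  odd-shape-suc-degenerate : ∀ j → + suc (suc (suc (double j))) ≈ 0ℤ → EvenShape j → OddShape (suc j)
  odd-shape-suc-degenerate j D₁≈0 shape-j = Shape-≡ A≡ B≡ C≡ (shape-step-degenerate (suc (double j)) D₁≈0 shape-j)
    where
    X = (+ p) ℤ.^ double j
    Y = (+ p) ℤ.^ j
    ε₁ = η p (σ (suc j))
    ε₃ = η p (σ (suc (suc j)))
    D₁ = + suc (suc (suc (double j)))
    D₂ = + suc (suc (suc (suc (double j))))
    ε₂≡0 = η-*-≈0 (σ (suc j)) D₁≈0
    z₃≡0 = δ-≉ (1+≈0⇒≉0 D₁≈0)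
    A≡ : + p * X - Y * η p (σ (suc j) * D₁) + (+ p - 1ℤ) * (+ p * X) ≡ + p * (+ p * X) - δ D₂ 0ℤ * (+ p * Y) * ε₃
    A≡ = trans (cong (λ e → + p * X - Y * e + (+ p - 1ℤ) * (+ p * X)) ε₂≡0)
               (trans (ring (+ p) X Y ε₃) (cong (λ z → + p * (+ p * X) - z * (+ p * Y) * ε₃) (sym z₃≡0)))
      where ring : ∀ P X Y e → P * X - Y * 0ℤ + (P - 1ℤ) * (P * X) ≡ P * (P * X) - 0ℤ * (P * Y) * e
            ring = solve-∀
    B≡ : + p * Y * η p (σ (suc j) * D₁) ≡ δ D₂ 0ℤ * (+ p * (+ p * Y)) * ε₃
    B≡ = trans (cong (+ p * Y *_) ε₂≡0)
               (trans (ring (+ p) Y ε₃) (cong (λ z → z * (+ p * (+ p * Y)) * ε₃) (sym z₃≡0)))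
      where ring : ∀ P Y e → P * Y * 0ℤ ≡ 0ℤ * (P * (P * Y)) * e
            ring = solve-∀
    C≡ : δ D₁ 0ℤ * (+ p * Y) * ε₁ ≡ + p * Y * η p (σ (suc j) * D₂)
    C≡ = trans (cong (λ z → z * (+ p * Y) * ε₁) (δ-≈ D₁≈0))
               (trans (cong (_* ε₁) (ℤ.*-identityˡ (+ p * Y))) (cong (+ p * Y *_) (sym (η-*-1+≈0 (σ (suc j)) D₁≈0))))

  odd-shape-suc-null : ∀ j → + suc (suc (suc (double j))) ≉ 0ℤ → + suc (suc (suc (suc (double j)))) ≈ 0ℤ →
                       EvenShape j → OddShape (suc j)
  odd-shape-suc-null j D₁≉0 D₂≈0 shape-j = Shape-≡ A≡ B≡ C≡ (shape-step-null (suc (suc (double j))) D₁≉0 D₂≈0 shape-j)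
    where
    X = (+ p) ℤ.^ double j
    Y = (+ p) ℤ.^ j
    ε₁ = η p (σ (suc j))
    ε₃ = η p (σ (suc (suc j)))
    D₁ = + suc (suc (suc (double j)))
    D₂ = + suc (suc (suc (suc (double j))))
    ε₂≡ε₃ : η p (σ (suc j) * D₁) ≡ ε₃
    ε₂≡ε₃ = η-*-≈-1 (σ (suc j)) D₂≈0
    z₃≡1 = δ-≈ D₂≈0
    A≡ : + p * (+ p * X - Y * η p (σ (suc j) * D₁)) ≡ + p * (+ p * X) - δ D₂ 0ℤ * (+ p * Y) * ε₃
    A≡ = trans (cong (λ e → + p * (+ p * X - Y * e)) ε₂≡ε₃)
               (trans (ring (+ p) X Y ε₃) (cong (λ z → + p * (+ p * X) - z * (+ p * Y) * ε₃) (sym z₃≡1)))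
      where ring : ∀ P X Y e → P * (P * X - Y * e) ≡ P * (P * X) - 1ℤ * (P * Y) * e
            ring = solve-∀
    B≡ : + p * (+ p * Y * η p (σ (suc j) * D₁)) ≡ δ D₂ 0ℤ * (+ p * (+ p * Y)) * ε₃
    B≡ = trans (cong (λ e → + p * (+ p * Y * e)) ε₂≡ε₃)
               (trans (ring (+ p) Y ε₃) (cong (λ z → z * (+ p * (+ p * Y)) * ε₃) (sym z₃≡1)))
      where ring : ∀ P Y e → P * (P * Y * e) ≡ 1ℤ * (P * (P * Y)) * e
            ring = solve-∀
    C≡ : + p * (δ D₁ 0ℤ * (+ p * Y) * ε₁) ≡ + p * Y * η p (σ (suc j) * D₂)
    C≡ = trans (cong (λ z → + p * (z * (+ p * Y) * ε₁)) (δ-≉ D₁≉0))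
               (trans (ring (+ p) Y ε₁) (cong (+ p * Y *_) (sym (η-*-≈0 (σ (suc j)) D₂≈0))))
      where ring : ∀ P Y e → P * (0ℤ * (P * Y) * e) ≡ P * Y * 0ℤ
            ring = solve-∀

  odd-shape-suc-generic : ∀ j → + suc (suc (suc (double j))) ≉ 0ℤ → + suc (suc (suc (suc (double j)))) ≉ 0ℤ →
                          EvenShape j → OddShape (suc j)
  odd-shape-suc-generic j D₁≉0 D₂≉0 shape-j = Shape-≡ A≡ B≡ C≡ (shape-step (suc (suc (double j))) D₁≉0 D₂≉0 shape-j)
    where
    X = (+ p) ℤ.^ double j
    Y = (+ p) ℤ.^ j
    ε₁ = η p (σ (suc j))
    ε₂ = η p (σ (suc j) * + suc (suc (suc (double j))))
    ε₃ = η p (σ (suc (suc j)))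
    D₁ = + suc (suc (suc (double j)))
    D₂ = + suc (suc (suc (suc (double j))))
    z₂≡0 = δ-≉ D₁≉0
    z₃≡0 = δ-≉ D₂≉0
    A≡ : + p * (+ p * X - Y * ε₂) + + p * Y * ε₂ - δ D₁ 0ℤ * (+ p * Y) * ε₁ * η p (- D₂ * D₁)
         ≡ + p * (+ p * X) - δ D₂ 0ℤ * (+ p * Y) * ε₃
    A≡ = trans (cong (λ z → + p * (+ p * X - Y * ε₂) + + p * Y * ε₂ - z * (+ p * Y) * ε₁ * η p (- D₂ * D₁)) z₂≡0)
               (trans (ring (+ p) X Y ε₁ ε₂ ε₃ (η p (- D₂ * D₁)))
                      (cong (λ z → + p * (+ p * X) - z * (+ p * Y) * ε₃) (sym z₃≡0)))
      where ring : ∀ P X Y e₁ e₂ e₃ f → P * (P * X - Y * e₂) + P * Y * e₂ - 0ℤ * (P * Y) * e₁ * f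
                                       ≡ P * (P * X) - 0ℤ * (P * Y) * e₃
            ring = solve-∀
    B≡ : + p * (δ D₁ 0ℤ * (+ p * Y) * ε₁) * η p (- D₂ * D₁) ≡ δ D₂ 0ℤ * (+ p * (+ p * Y)) * ε₃
    B≡ = trans (cong (λ z → + p * (z * (+ p * Y) * ε₁) * η p (- D₂ * D₁)) z₂≡0)
               (trans (ring (+ p) Y ε₁ ε₃ (η p (- D₂ * D₁)))
                      (cong (λ z → z * (+ p * (+ p * Y)) * ε₃) (sym z₃≡0)))
      where ring : ∀ P Y e₁ e₃ f → P * (0ℤ * (P * Y) * e₁) * f ≡ 0ℤ * (P * (P * Y)) * e₃
            ring = solve-∀
    C≡ : + p * Y * ε₂ * η p (D₂ * D₁) ≡ + p * Y * η p (σ (suc j) * D₂)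
    C≡ = trans (ℤ.*-assoc (+ p * Y) ε₂ (η p (D₂ * D₁))) (cong (+ p * Y *_) (η-*-common D₁≉0 (σ (suc j)) D₂))

  odd-shape-suc : ∀ j → EvenShape j → OddShape (suc j)
  odd-shape-suc j with + suc (suc (suc (double j))) ≈? 0ℤ | + suc (suc (suc (suc (double j)))) ≈? 0ℤ
  ... | yes D₁≈0 | _        = odd-shape-suc-degenerate j D₁≈0
  ... | no D₁≉0  | yes D₂≈0 = odd-shape-suc-null j D₁≉0 D₂≈0
  ... | no D₁≉0  | no D₂≉0  = odd-shape-suc-generic j D₁≉0 D₂≉0

  shapes : ∀ j → OddShape j × EvenShape j
  shapes zero    = odd-shape-0 , even-shape 0 odd-shape-0
  shapes (suc j) = let odd-j = odd-shape-suc j (proj₂ (shapes j)) in odd-j , even-shape (suc j) odd-j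

module ZerosOfE₂ {p : ℕ} (p-prime : Prime p) (2<p : 2 ℕ.< p) where

  open Residues p-prime
  open QuadraticCharacter p-prime 2<p
  open QuadraticForms p-prime 2<p

  𝟙[p∣e₂]≡δ : ∀ {k} (v : Vec ℕ k) → 𝟙 (p ∣? e₂ v) ≡ δ (+ Vec.sum v * + Vec.sum v - + sumSq v) 0ℤ
  𝟙[p∣e₂]≡δ v = 𝟙-cong (p ∣? e₂ v) (S * S - Q ≈? 0ℤ)
    (λ p∣e → ≈-trans (≈-reflexive S²-Q≡2e) (≈-trans (*-congˡ (+ 2) (∣⇒≈0 p∣e)) (≈-reflexive (ℤ.*-zeroʳ (+ 2)))))
    (λ S²-Q≈0 → ≈0⇒∣ ([ (λ 2≈0 → contradiction 2≈0 2≉0) , id ]′ (*≈0⇒≈0⊎≈0 (≈-trans (≈-reflexive (sym S²-Q≡2e)) S²-Q≈0))))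
    where
    S = + Vec.sum v
    Q = + sumSq v
    S²-Q≡2e : S * S - Q ≡ + 2 * + e₂ v
    S²-Q≡2e = begin
      S * S - Q                         ≡⟨ cong (_- Q) (ℤ.pos-* (Vec.sum v) (Vec.sum v)) ⟨
      + (Vec.sum v ℕ.* Vec.sum v) - Q   ≡⟨ cong (λ n → + n - Q) (2e₂+sumSq≡sum² v) ⟨
      + (2 ℕ.* e₂ v ℕ.+ sumSq v) - Q    ≡⟨ cong (_- Q) (trans (ℤ.pos-+ (2 ℕ.* e₂ v) (sumSq v)) (cong (_+ Q) (ℤ.pos-* 2 (e₂ v)))) ⟩
      + 2 * + e₂ v + Q - Q              ≡⟨ cancel (+ 2 * + e₂ v) Q ⟩
      + 2 * + e₂ v                      ∎
      where
      open ≡-Reasoning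
      cancel : ∀ x q → x + q - q ≡ x
      cancel = solve-∀

  private
    ∑ₚ²-level-translate : ∀ m {φ : ℤ → ℤ → ℤ} → φ Preserves₂ _≈_ ⟶ _≈_ ⟶ _≡_ → ∀ a →
                          ∑ₚ[ s ] ∑ₚ[ q ] (level m (s - a) (q - a * a) * φ s q)
                          ≡ ∑ₚ[ s ] ∑ₚ[ q ] (level m s q * φ (s + a) (q + a * a))
    ∑ₚ²-level-translate m {φ} φ-cong a = begin
      ∑ₚ[ s ] ∑ₚ[ q ] (level m (s - a) (q - a * a) * φ s q)
        ≡⟨ ∑ₚ-shift {λ s → ∑ₚ[ q ] (level m (s - a) (q - a * a) * φ s q)}
             (λ s≈s′ → ∑ₚ-cong (λ q → cong₂ _*_ (level-cong m (+-congʳ (- a) s≈s′) (≈-refl {q - a * a}))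
                                                (φ-cong s≈s′ (≈-refl {q})))) a ⟨
      ∑ₚ[ s ] ∑ₚ[ q ] (level m (s + a - a) (q - a * a) * φ (s + a) q)
        ≡⟨ ∑ₚ-cong (λ s → ∑ₚ-shift {λ q → level m (s + a - a) (q - a * a) * φ (s + a) q}
             (λ q≈q′ → cong₂ _*_ (level-cong m (≈-refl {s + a - a}) (+-congʳ (- (a * a)) q≈q′))
                                 (φ-cong (≈-refl {s + a}) q≈q′)) (a * a)) ⟨
      ∑ₚ[ s ] ∑ₚ[ q ] (level m (s + a - a) (q + a * a - a * a) * φ (s + a) (q + a * a))
        ≡⟨ ∑ₚ-cong (λ s → ∑ₚ-cong (λ q → cong₂ (λ x y → level m x y * φ (s + a) (q + a * a)) (cancel s a) (cancel q (a * a)))) ⟩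
      ∑ₚ[ s ] ∑ₚ[ q ] (level m s q * φ (s + a) (q + a * a)) ∎
      where
      open ≡-Reasoning
      cancel : ∀ x a → x + a - a ≡ x
      cancel = solve-∀

  ∑ᵛ-level : ∀ m {φ : ℤ → ℤ → ℤ} → φ Preserves₂ _≈_ ⟶ _≈_ ⟶ _≡_ →
             ∑ᵛ p m (λ v → φ (+ Vec.sum v) (+ sumSq v)) ≡ ∑ₚ[ s ] ∑ₚ[ q ] (level m s q * φ s q)
  ∑ᵛ-level zero {φ} φ-cong = sym (begin
    ∑ₚ[ s ] ∑ₚ[ q ] (δ s 0ℤ * δ q 0ℤ * φ s q)   ≡⟨ ∑ₚ-cong (λ s → trans (∑ₚ-cong (λ q → ℤ.*-assoc (δ s 0ℤ) (δ q 0ℤ) (φ s q)))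
                                                                       (∑ₚ-*ˡ (δ s 0ℤ) (λ q → δ q 0ℤ * φ s q))) ⟩
    ∑ₚ[ s ] (δ s 0ℤ * ∑ₚ[ q ] (δ q 0ℤ * φ s q))  ≡⟨ ∑ₚ-cong (λ s → cong (δ s 0ℤ *_) (∑ₚ-δ-* (φ-cong (≈-refl {s})) 0ℤ)) ⟩
    ∑ₚ[ s ] (δ s 0ℤ * φ s 0ℤ)                    ≡⟨ ∑ₚ-δ-* {λ s → φ s 0ℤ} (λ s≈s′ → φ-cong s≈s′ ≈-refl) 0ℤ ⟩
    φ 0ℤ 0ℤ                                      ∎)
    where open ≡-Reasoning
  ∑ᵛ-level (suc m) {φ} φ-cong = begin
    ∑ᵛ p (suc m) (λ v → φ (+ Vec.sum v) (+ sumSq v))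
      ≡⟨ sum-cong-≗ {p} (λ i → trans (∑ᵛ-cong p m (λ v → cong₂ φ (ℤ.pos-+ (toℕ i) (Vec.sum v)) (pos-a²+q (toℕ i) (sumSq v))))
                                 (∑ᵛ-level m (λ s≈s′ q≈q′ → φ-cong (+-congˡ (+ toℕ i) s≈s′) (+-congˡ (+ toℕ i * + toℕ i) q≈q′)))) ⟩
    ∑ₚ[ a ] ∑ₚ[ s ] ∑ₚ[ q ] (level m s q * φ (a + s) (a * a + q))
      ≡⟨ ∑ₚ-cong (λ a → ∑ₚ-cong (λ s → ∑ₚ-cong (λ q → cong (level m s q *_) (cong₂ φ (ℤ.+-comm a s) (ℤ.+-comm (a * a) q))))) ⟩
    ∑ₚ[ a ] ∑ₚ[ s ] ∑ₚ[ q ] (level m s q * φ (s + a) (q + a * a))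
      ≡⟨ ∑ₚ-cong (∑ₚ²-level-translate m φ-cong) ⟨
    ∑ₚ[ a ] ∑ₚ[ s ] ∑ₚ[ q ] (level m (s - a) (q - a * a) * φ s q)
      ≡⟨ ∑ₚ-comm (λ a s → ∑ₚ[ q ] (level m (s - a) (q - a * a) * φ s q)) ⟩
    ∑ₚ[ s ] ∑ₚ[ a ] ∑ₚ[ q ] (level m (s - a) (q - a * a) * φ s q)
      ≡⟨ ∑ₚ-cong (λ s → ∑ₚ-comm (λ a q → level m (s - a) (q - a * a) * φ s q)) ⟩
    ∑ₚ[ s ] ∑ₚ[ q ] ∑ₚ[ a ] (level m (s - a) (q - a * a) * φ s q)
      ≡⟨ ∑ₚ-cong (λ s → ∑ₚ-cong (λ q → ∑ₚ-*ʳ (φ s q) (λ a → level m (s - a) (q - a * a)))) ⟩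
    ∑ₚ[ s ] ∑ₚ[ q ] (level (suc m) s q * φ s q) ∎
    where
    open ≡-Reasoning
    pos-a²+q : ∀ a q → + (a ℕ.* a ℕ.+ q) ≡ + a * + a + + q
    pos-a²+q a q = trans (ℤ.pos-+ (a ℕ.* a) q) (cong (_+ + q) (ℤ.pos-* a a))

  N≡∑ₚ-level-diagonal : ∀ m → + N m p ≡ ∑ₚ[ s ] level m s (s * s)
  N≡∑ₚ-level-diagonal m = begin
    + N m p                                             ≡⟨ N≡∑ᵛ m p ⟩
    ∑ᵛ p m (λ v → 𝟙 (p ∣? e₂ v))                        ≡⟨ ∑ᵛ-cong p m 𝟙[p∣e₂]≡δ ⟩
    ∑ᵛ p m (λ v → δ (+ Vec.sum v * + Vec.sum v - + sumSq v) 0ℤ)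
      ≡⟨ ∑ᵛ-level m {λ s q → δ (s * s - q) 0ℤ} (λ s≈s′ q≈q′ → δ-congˡ 0ℤ (+-cong (*-cong s≈s′ s≈s′) (-‿cong q≈q′))) ⟩
    ∑ₚ[ s ] ∑ₚ[ q ] (level m s q * δ (s * s - q) 0ℤ)    ≡⟨ ∑ₚ-cong diagonal ⟩
    ∑ₚ[ s ] level m s (s * s)                           ∎
    where
    open ≡-Reasoning
    diagonal : ∀ s → ∑ₚ[ q ] (level m s q * δ (s * s - q) 0ℤ) ≡ level m s (s * s)
    diagonal s = trans (∑ₚ-cong (λ q → trans (ℤ.*-comm (level m s q) (δ (s * s - q) 0ℤ))
                                             (cong (_* level m s q) (δ-cong {s * s - q} {0ℤ} {q} {s * s}
                                               (λ s²-q≈0 → ≈-sym (-≈0⇒≈ s²-q≈0)) (λ q≈s² → ≈⇒-≈0 (≈-sym q≈s²))))))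
                       (∑ₚ-δ-* (level-cong m (≈-refl {s})) (s * s))

  private
    ∑ₚ-level-line : ∀ n {b} → b ≉ 0ℤ → ∑ₚ[ a ] level (suc n) b (+ 2 * b * a + b * b) ≡ (+ p) ℤ.^ n
    ∑ₚ-level-line n {b} b≉0 =
      trans (∑ₚ-affine (level-cong (suc n) (≈-refl {b})) (*-≉0 2≉0 b≉0) (b * b)) (∑ₚ-level n b)

    ∑ₚ-level-line-0 : ∀ n {b} → b ≈ 0ℤ → ∑ₚ[ a ] level (suc n) b (+ 2 * b * a + b * b) ≡ + p * reps n 0ℤ
    ∑ₚ-level-line-0 n {b} b≈0 = begin
      ∑ₚ[ a ] level (suc n) b (+ 2 * b * a + b * b)   ≡⟨ ∑ₚ-cong (λ a → level-cong (suc n) b≈0 (2ba+b²≈0 a)) ⟩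
      ∑ₚ[ a ] level (suc n) 0ℤ 0ℤ                     ≡⟨ ∑ₚ-const (level (suc n) 0ℤ 0ℤ) ⟩
      + p * level (suc n) 0ℤ 0ℤ                       ≡⟨ cong (+ p *_) (level-0≡reps n 0ℤ) ⟩
      + p * reps n 0ℤ                                 ∎
      where
      open ≡-Reasoning
      vanish : ∀ a → + 2 * 0ℤ * a + 0ℤ * 0ℤ ≡ 0ℤ
      vanish = solve-∀
      2ba+b²≈0 : ∀ a → + 2 * b * a + b * b ≈ 0ℤ
      2ba+b²≈0 a = ≈-trans (+-cong (*-congʳ a (*-congˡ (+ 2) b≈0)) (*-cong b≈0 b≈0)) (≈-reflexive (vanish a))

  -- Writing x = (a, y) with b = ∑y, the condition (∑x)² = ∑x² becomes 2ab + b² = ∑y²: for b ≉ 0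
  -- exactly one a works for each y, while for b ≈ 0 every a works iff ∑y² ≈ 0.
  ∑ₚ-level-diagonal : ∀ n → ∑ₚ[ s ] level (suc (suc n)) s (s * s) ≡ + p * reps n 0ℤ + (+ p - 1ℤ) * (+ p) ℤ.^ n
  ∑ₚ-level-diagonal n = begin
    ∑ₚ[ s ] ∑ₚ[ a ] level m (s - a) (s * s - a * a)
      ≡⟨ ∑ₚ-comm (λ s a → level m (s - a) (s * s - a * a)) ⟩
    ∑ₚ[ a ] ∑ₚ[ s ] level m (s - a) (s * s - a * a)
      ≡⟨ ∑ₚ-cong (λ a → ∑ₚ-shift {λ s → level m (s - a) (s * s - a * a)}
                           (λ s≈s′ → level-cong m (+-congʳ (- a) s≈s′) (+-congʳ (- (a * a)) (*-cong s≈s′ s≈s′))) a) ⟨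
    ∑ₚ[ a ] ∑ₚ[ b ] level m (b + a - a) ((b + a) * (b + a) - a * a)
      ≡⟨ ∑ₚ-cong (λ a → ∑ₚ-cong (λ b → cong₂ (level m) (cancel b a) (expand b a))) ⟩
    ∑ₚ[ a ] ∑ₚ[ b ] level m b (+ 2 * b * a + b * b)
      ≡⟨ ∑ₚ-comm (λ a b → level m b (+ 2 * b * a + b * b)) ⟩
    ∑ₚ[ b ] ∑ₚ[ a ] level m b (+ 2 * b * a + b * b)
      ≡⟨ ∑ₚ-by-cases (∑ₚ-level-line-0 n) (∑ₚ-level-line n) ⟩
    + p * reps n 0ℤ + (+ p - 1ℤ) * (+ p) ℤ.^ n ∎
    where
    open ≡-Reasoning
    m = suc n
    cancel : ∀ b a → b + a - a ≡ b
    cancel = solve-∀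
    expand : ∀ b a → (b + a) * (b + a) - a * a ≡ + 2 * b * a + b * b
    expand = solve-∀

  N-via-reps : ∀ n → + N (suc (suc n)) p ≡ + p * reps n 0ℤ + (+ p - 1ℤ) * (+ p) ℤ.^ n
  N-via-reps n = trans (N≡∑ₚ-level-diagonal (suc (suc n))) (∑ₚ-level-diagonal n)

module OddCharacteristic {p : ℕ} (p-prime : Prime p) (2<p : 2 ℕ.< p) where

  open Residues p-prime
  open QuadraticCharacter p-prime 2<p
  open QuadraticForms p-prime 2<p
  open RepresentationShapes p-prime 2<p
  open ZerosOfE₂ p-prime 2<p

  +p^≡ : ∀ n → + (p ℕ.^ n) ≡ (+ p) ℤ.^ n
  +p^≡ zero    = refl
  +p^≡ (suc n) = trans (ℤ.pos-* p (p ℕ.^ n)) (cong (+ p *_) (+p^≡ n))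

  +p∸1≡ : + (p ∸ 1) ≡ + p - 1ℤ
  +p∸1≡ = sym (trans (ℤ.m-n≡m⊖n p 1) (ℤ.⊖-≥ (ℕ.<⇒≤ (ℕ.<-trans (ℕ.s≤s (ℕ.s≤s ℕ.z≤n)) 2<p))))

  gcd≡p : ∀ {d} → p ℕ.∣ d → gcd d p ≡ p
  gcd≡p {d} p∣d with prime⇒irreducible p-prime (gcd[m,n]∣n d p)
  ... | inj₂ gcd≡p = gcd≡p
  ... | inj₁ gcd≡1 = contradiction (∣⇒≈0 (subst (p ℕ.∣_) gcd≡1 (gcd-greatest p∣d (ℕ.∣-refl {p})))) 1≉0

  gcd≡1 : ∀ {d} → ¬ p ℕ.∣ d → gcd d p ≡ 1
  gcd≡1 {d} p∤d with prime⇒irreducible p-prime (gcd[m,n]∣n d p)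
  ... | inj₁ gcd≡1 = gcd≡1
  ... | inj₂ gcd≡p = contradiction (subst (ℕ._∣ d) gcd≡p (gcd[m,n]∣m d p)) p∤d

  δ*η≡η[1-gcd] : ∀ d s → δ (+ d) 0ℤ * η p s ≡ η p (s * (+ 1 - + gcd d p))
  δ*η≡η[1-gcd] d s with + d ≈? 0ℤ
  ... | yes d≈0 = begin
    δ (+ d) 0ℤ * η p s               ≡⟨ cong (_* η p s) (δ-≈ d≈0) ⟩
    1ℤ * η p s                       ≡⟨ ℤ.*-identityˡ (η p s) ⟩
    η p s                            ≡⟨ η-cong s≈s[1-p] ⟩
    η p (s * (+ 1 - + p))            ≡⟨ cong (λ g → η p (s * (+ 1 - + g))) (gcd≡p (≈0⇒∣ d≈0)) ⟨
    η p (s * (+ 1 - + gcd d p))      ∎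
    where
    open ≡-Reasoning
    s≈s[1-p] : s ≈ s * (+ 1 - + p)
    s≈s[1-p] = ≈-trans (≈-reflexive (sym (ℤ.*-identityʳ s))) (*-congˡ s (≈-sym (+-congˡ 1ℤ (-‿cong p≈0))))
  ... | no d≉0 = begin
    δ (+ d) 0ℤ * η p s               ≡⟨ cong (_* η p s) (δ-≉ d≉0) ⟩
    0ℤ                               ≡⟨ η-null (≈-reflexive (ℤ.*-zeroʳ s)) ⟨
    η p (s * 0ℤ)                     ≡⟨ cong (λ g → η p (s * (+ 1 - + g))) (gcd≡1 (d≉0 ∘′ ∣⇒≈0)) ⟨
    η p (s * (+ 1 - + gcd d p))      ∎
    where open ≡-Reasoning

  OddFormula EvenFormula : ℕ → Set
  OddFormula k  = + N k p ≡ + (p ℕ.^ (k ∸ 1)) + + (p ∸ 1) * + (p ℕ.^ ((k ∸ 1) / 2))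
                            * η p ((- + 1) ℤ.^ ((k ∸ 1) / 2) * (+ 1 - + gcd (k ∸ 1) p))
  EvenFormula k = + N k p ≡ + (p ℕ.^ (k ∸ 1)) + + (p ∸ 1) * + (p ℕ.^ ((k ∸ 2) / 2))
                            * η p ((- + 1) ℤ.^ (k / 2 ℕ.+ 1) * + (k ∸ 1))

  N-2 : EvenFormula 2
  N-2 = begin
    + N 2 p                                   ≡⟨ N-via-reps 0 ⟩
    + p * reps 0 0ℤ + (+ p - 1ℤ) * 1ℤ         ≡⟨ cong (λ r → + p * r + (+ p - 1ℤ) * 1ℤ) (Shape-at-0 reps-0-shape) ⟩
    + p * (0ℤ + 1ℤ) + (+ p - 1ℤ) * 1ℤ         ≡⟨ regroup (+ p) ⟩
    + p * 1ℤ + (+ p - 1ℤ) * 1ℤ * 1ℤ           ≡⟨ cong₂ (λ a b → a + b * 1ℤ * 1ℤ) (+p^≡ 1) +p∸1≡ ⟨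
    + (p ℕ.^ 1) + + (p ∸ 1) * 1ℤ * 1ℤ         ≡⟨ cong (λ e → + (p ℕ.^ 1) + + (p ∸ 1) * 1ℤ * e) (η-square 1≉0 1ℤ ≈-refl) ⟨
    + (p ℕ.^ 1) + + (p ∸ 1) * 1ℤ * η p 1ℤ     ∎
    where
    open ≡-Reasoning
    regroup : ∀ P → P * (0ℤ + 1ℤ) + (P - 1ℤ) * 1ℤ ≡ P * 1ℤ + (P - 1ℤ) * 1ℤ * 1ℤ
    regroup = solve-∀

  N-odd : ∀ j → OddFormula (suc (suc (suc (double j))))
  N-odd j = begin
    + N (suc (suc n)) p
      ≡⟨ N-via-reps n ⟩
    + p * reps n 0ℤ + (+ p - 1ℤ) * (+ p) ℤ.^ n
      ≡⟨ cong (λ r → + p * r + (+ p - 1ℤ) * (+ p) ℤ.^ n) (Shape-at-0 (proj₁ (shapes j))) ⟩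
    + p * (X - z * Y * ε + z * (+ p * Y) * ε) + (+ p - 1ℤ) * (+ p * X)
      ≡⟨ regroup (+ p) X Y z ε ⟩
    + p * (+ p * X) + (+ p - 1ℤ) * (+ p * Y) * (z * ε)
      ≡⟨ cong₂ (λ a b → a + b * (+ p * Y) * (z * ε)) (+p^≡ (suc n)) +p∸1≡ ⟨
    + (p ℕ.^ suc n) + + (p ∸ 1) * (+ p * Y) * (z * ε)
      ≡⟨ cong₂ (λ a b → + (p ℕ.^ suc n) + + (p ∸ 1) * a * b) p^[j+1]≡ (δ*η≡η[1-gcd] (suc n) (σ (suc j))) ⟩
    + (p ℕ.^ suc n) + + (p ∸ 1) * + (p ℕ.^ (suc j)) * η p (σ (suc j) * (+ 1 - + gcd (suc n) p))
      ≡⟨ cong (λ i → + (p ℕ.^ suc n) + + (p ∸ 1) * + (p ℕ.^ i) * η p (σ i * (+ 1 - + gcd (suc n) p))) (double/2≡id (suc j)) ⟨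
    + (p ℕ.^ suc n) + + (p ∸ 1) * + (p ℕ.^ (suc n / 2)) * η p (σ (suc n / 2) * (+ 1 - + gcd (suc n) p)) ∎
    where
    open ≡-Reasoning
    n = suc (double j)
    X = (+ p) ℤ.^ double j
    Y = (+ p) ℤ.^ j
    z = δ (+ suc n) 0ℤ
    ε = η p (σ (suc j))
    p^[j+1]≡ : + p * Y ≡ + (p ℕ.^ suc j)
    p^[j+1]≡ = sym (+p^≡ (suc j))
    regroup : ∀ P X Y z e → P * (X - z * Y * e + z * (P * Y) * e) + (P - 1ℤ) * (P * X)
                            ≡ P * (P * X) + (P - 1ℤ) * (P * Y) * (z * e)
    regroup = solve-∀

  N-even : ∀ j → EvenFormula (suc (suc (suc (suc (double j)))))
  N-even j = begin
    + N (suc (suc n)) p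
      ≡⟨ N-via-reps n ⟩
    + p * reps n 0ℤ + (+ p - 1ℤ) * (+ p) ℤ.^ n
      ≡⟨ cong (λ r → + p * r + (+ p - 1ℤ) * (+ p) ℤ.^ n) (Shape-at-0 (proj₂ (shapes j))) ⟩
    + p * (+ p * X - Y * ε + + p * Y * ε) + (+ p - 1ℤ) * (+ p * (+ p * X))
      ≡⟨ regroup (+ p) X Y ε ⟩
    + p * (+ p * (+ p * X)) + (+ p - 1ℤ) * (+ p * Y) * ε
      ≡⟨ cong₂ (λ a b → a + b * (+ p * Y) * ε) (+p^≡ (suc n)) +p∸1≡ ⟨
    + (p ℕ.^ suc n) + + (p ∸ 1) * (+ p * Y) * ε
      ≡⟨ cong₂ (λ a e → + (p ℕ.^ suc n) + + (p ∸ 1) * a * η p (e * D)) (sym (+p^≡ (suc j))) σ≡ ⟩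
    + (p ℕ.^ suc n) + + (p ∸ 1) * + (p ℕ.^ suc j) * η p ((- + 1) ℤ.^ (suc (suc j) ℕ.+ 1) * D)
      ≡⟨ cong₂ (λ i l → + (p ℕ.^ suc n) + + (p ∸ 1) * + (p ℕ.^ i) * η p ((- + 1) ℤ.^ (l ℕ.+ 1) * D))
               (double/2≡id (suc j)) (double/2≡id (suc (suc j))) ⟨
    + (p ℕ.^ suc n) + + (p ∸ 1) * + (p ℕ.^ (n / 2)) * η p ((- + 1) ℤ.^ (suc (suc n) / 2 ℕ.+ 1) * D) ∎
    where
    open ≡-Reasoning
    n = suc (suc (double j))
    X = (+ p) ℤ.^ double j
    Y = (+ p) ℤ.^ j
    D = + suc n
    ε = η p (σ (suc j) * D)
    σ≡ : σ (suc j) ≡ (- + 1) ℤ.^ (suc (suc j) ℕ.+ 1)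
    σ≡ = trans (sym (cancel (σ (suc j)))) (cong (λ i → -1ℤ * (-1ℤ * σ i)) (ℕ.+-comm 1 j))
      where cancel : ∀ x → -1ℤ * (-1ℤ * x) ≡ x
            cancel = solve-∀
    regroup : ∀ P X Y e → P * (P * X - Y * e + P * Y * e) + (P - 1ℤ) * (P * (P * X))
                          ≡ P * (P * (P * X)) + (P - 1ℤ) * (P * Y) * e
    regroup = solve-∀

  N-formula : ∀ {n} → Parity n → let k = suc (suc n) in (k % 2 ≡ 1 → OddFormula k) × (k % 2 ≡ 0 → EvenFormula k)
  N-formula (even zero)    = (λ ()) , λ _ → N-2
  N-formula (even (suc j)) = (λ k%2≡1 → contradiction (trans (sym (double%2≡0 (suc (suc j)))) k%2≡1) λ ()) , λ _ → N-even j
  N-formula (odd j)        = (λ _ → N-odd j) , (λ k%2≡0 → contradiction (trans (sym (suc-double%2≡1 (suc j))) k%2≡0) λ ())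

module Characteristic2 where

  weightSum : ℕ → (ℕ → ℕ → ℤ) → ℤ
  weightSum k φ = ∑ᵛ 2 k (λ v → φ (Vec.sum v) (e₂ v))

  addCoordinate : (ℕ → ℕ → ℤ) → ℕ → ℕ → ℤ
  addCoordinate φ s e = φ (suc s) (s ℕ.+ e)

  weightSum-suc : ∀ k φ → weightSum (suc k) φ ≡ weightSum k φ + weightSum k (addCoordinate φ)
  weightSum-suc k φ = cong (_+_ (weightSum k φ)) (trans (ℤ.+-identityʳ _)
    (∑ᵛ-cong 2 k (λ v → cong (λ x → φ (suc (Vec.sum v)) (x ℕ.+ e₂ v)) (ℕ.+-identityʳ (Vec.sum v)))))

  Periodic : (ℕ → ℕ → ℤ) → Set
  Periodic φ = (∀ s e → φ (2 ℕ.+ s) e ≡ φ s e) × (∀ s e → φ s (2 ℕ.+ e) ≡ φ s e)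

  addCoordinate-periodic : ∀ φ → Periodic φ → Periodic (addCoordinate φ)
  addCoordinate-periodic φ (φ-per-s , φ-per-e) =
    (λ s e → trans (φ-per-s (suc s) (2 ℕ.+ (s ℕ.+ e))) (φ-per-e (suc s) (s ℕ.+ e))) ,
    (λ s e → trans (cong (φ (suc s)) (trans (ℕ.+-suc s (suc e)) (cong suc (ℕ.+-suc s e)))) (φ-per-e (suc s) (s ℕ.+ e)))

  2^suc≡2^+2^ : ∀ n → + (2 ℕ.^ suc n) ≡ + (2 ℕ.^ n) + + (2 ℕ.^ n)
  2^suc≡2^+2^ n = trans (ℤ.pos-* 2 (2 ℕ.^ n)) (twice (+ (2 ℕ.^ n)))
    where twice : ∀ x → + 2 * x ≡ x + x
          twice = solve-∀

  -- (∑x, e₂ x) mod 2 is (0,0), (1,0), (0,1), (1,1) exactly when ∑x ≡ 0, 1, 2, 3 (mod 4).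
  fourier : ℕ → (ℕ → ℕ → ℤ) → ℤ
  fourier k φ = φ 0 0 * (T + + 2 * X) + φ 1 0 * (T + + 2 * Y) + φ 0 1 * (T - + 2 * X) + φ 1 1 * (T - + 2 * Y)
    where
    T = + (2 ℕ.^ k)
    X = re (onePlusIPow k)
    Y = im (onePlusIPow k)

  4*weightSum≡fourier : ∀ k φ → Periodic φ → + 4 * weightSum (suc k) φ ≡ fourier (suc k) φ
  4*weightSum≡fourier zero φ _ = base (φ 0 0) (φ 1 0) (φ 0 1) (φ 1 1)
    where base : ∀ a b c d → + 4 * (a + (b + 0ℤ))
                             ≡ a * (+ 2 + + 2 * 1ℤ) + b * (+ 2 + + 2 * 1ℤ) + c * (+ 2 - + 2 * 1ℤ) + d * (+ 2 - + 2 * 1ℤ)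
          base = solve-∀
  4*weightSum≡fourier (suc k) φ φ-per@(φ-per-s , φ-per-e) = begin
    + 4 * weightSum (suc (suc k)) φ
      ≡⟨ cong (+ 4 *_) (weightSum-suc (suc k) φ) ⟩
    + 4 * (weightSum (suc k) φ + weightSum (suc k) (addCoordinate φ))
      ≡⟨ ℤ.*-distribˡ-+ (+ 4) (weightSum (suc k) φ) (weightSum (suc k) (addCoordinate φ)) ⟩
    + 4 * weightSum (suc k) φ + + 4 * weightSum (suc k) (addCoordinate φ)
      ≡⟨ cong₂ _+_ (4*weightSum≡fourier k φ φ-per)
                   (4*weightSum≡fourier k (addCoordinate φ) (addCoordinate-periodic φ φ-per)) ⟩
    fourier (suc k) φ + (φ 1 0 * (T + + 2 * X) + φ 2 1 * (T + + 2 * Y) + φ 1 1 * (T - + 2 * X) + φ 2 2 * (T - + 2 * Y))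
      ≡⟨ cong₂ (λ a b → fourier (suc k) φ + (φ 1 0 * (T + + 2 * X) + a * (T + + 2 * Y) + φ 1 1 * (T - + 2 * X) + b * (T - + 2 * Y)))
               (φ-per-s 0 1) (trans (φ-per-s 0 2) (φ-per-e 0 0)) ⟩
    fourier (suc k) φ + (φ 1 0 * (T + + 2 * X) + φ 0 1 * (T + + 2 * Y) + φ 1 1 * (T - + 2 * X) + φ 0 0 * (T - + 2 * Y))
      ≡⟨ combine (φ 0 0) (φ 1 0) (φ 0 1) (φ 1 1) T X Y ⟩
    fourier′ (T + T)
      ≡⟨ cong fourier′ (2^suc≡2^+2^ (suc k)) ⟨
    fourier (suc (suc k)) φ ∎
    where
    open ≡-Reasoning
    T = + (2 ℕ.^ suc k)
    X = re (onePlusIPow (suc k))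
    Y = im (onePlusIPow (suc k))
    fourier′ : ℤ → ℤ
    fourier′ T′ = φ 0 0 * (T′ + + 2 * (X - Y)) + φ 1 0 * (T′ + + 2 * (X + Y)) + φ 0 1 * (T′ - + 2 * (X - Y)) + φ 1 1 * (T′ - + 2 * (X + Y))
    combine : ∀ a b c d T X Y →
      a * (T + + 2 * X) + b * (T + + 2 * Y) + c * (T - + 2 * X) + d * (T - + 2 * Y)
        + (b * (T + + 2 * X) + c * (T + + 2 * Y) + d * (T - + 2 * X) + a * (T - + 2 * Y))
      ≡ a * (T + T + + 2 * (X - Y)) + b * (T + T + + 2 * (X + Y)) + c * (T + T - + 2 * (X - Y)) + d * (T + T - + 2 * (X + Y))
    combine = solve-∀

  e₂-even : ℕ → ℕ → ℤ
  e₂-even _ e = 𝟙 (2 ∣? e)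

  e₂-even-periodic : Periodic e₂-even
  e₂-even-periodic = (λ _ _ → refl) ,
    (λ _ e → 𝟙-cong (2 ∣? (2 ℕ.+ e)) (2 ∣? e) (λ 2∣2+e → ℕ.∣m+n∣m⇒∣n 2∣2+e (ℕ.∣-refl {2})) (ℕ.∣m∣n⇒∣m+n (ℕ.∣-refl {2})))

  4*N≡ : ∀ k → + 4 * + N (suc k) 2 ≡ + (2 ℕ.^ (suc k ℕ.+ 1)) + + 2 * sqrt2PowCos (suc k)
  4*N≡ k = begin
    + 4 * + N (suc k) 2                           ≡⟨ cong (+ 4 *_) (N≡∑ᵛ (suc k) 2) ⟩
    + 4 * weightSum (suc k) e₂-even               ≡⟨ 4*weightSum≡fourier k e₂-even e₂-even-periodic ⟩
    fourier (suc k) e₂-even                       ≡⟨ evaluate T a b ⟩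
    T + T + + 2 * (+ 2 * a)                       ≡⟨ cong (_+ + 2 * (+ 2 * a)) (2^suc≡2^+2^ (suc k)) ⟨
    + (2 ℕ.^ suc (suc k)) + + 2 * (+ 2 * a)       ≡⟨ cong (λ n → + (2 ℕ.^ n) + + 2 * (+ 2 * a)) (ℕ.+-comm (suc k) 1) ⟨
    + (2 ℕ.^ (suc k ℕ.+ 1)) + + 2 * sqrt2PowCos (suc k) ∎
    where
    open ≡-Reasoning
    T = + (2 ℕ.^ suc k)
    a = re (onePlusIPow k)
    b = im (onePlusIPow k)
    evaluate : ∀ T a b → 1ℤ * (T + + 2 * (a - b)) + 1ℤ * (T + + 2 * (a + b)) + 0ℤ * (T - + 2 * (a - b)) + 0ℤ * (T - + 2 * (a + b))
                         ≡ T + T + + 2 * (+ 2 * a)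
    evaluate = solve-∀

mainTheorem2 : (k : ℕ) → 1 < k →
    ((p : ℕ) → Prime p → 2 < p →
      (k % 2 ≡ 1 →
        + N k p ≡ + (p ^ (k ∸ 1)) ℤ.+ + (p ∸ 1) ℤ.* + (p ^ ((k ∸ 1) / 2))
                   ℤ.* η p ((ℤ.- + 1) ℤ.^ ((k ∸ 1) / 2) ℤ.* (+ 1 ℤ.- + gcd (k ∸ 1) p)))
      × (k % 2 ≡ 0 →
        + N k p ≡ + (p ^ (k ∸ 1)) ℤ.+ + (p ∸ 1) ℤ.* + (p ^ ((k ∸ 2) / 2))
                   ℤ.* η p ((ℤ.- + 1) ℤ.^ (k / 2 ℕ.+ 1) ℤ.* + (k ∸ 1))))
  × (+ 4 ℤ.* + N k 2 ≡ + (2 ^ (k ℕ.+ 1)) ℤ.+ + 2 ℤ.* sqrt2PowCos k)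
mainTheorem2 zero          ()
mainTheorem2 (suc zero)    (ℕ.s≤s ())
mainTheorem2 (suc (suc n)) _ = (λ p p-prime 2<p → OddCharacteristic.N-formula p-prime 2<p (parity n)) , Characteristic2.4*N≡ (suc n)
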